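{- Define polynomials $f_n(u)$ by $\sum_{n=0}^\infty f_n(u) q^n = \prod_{n=1}^\infty \frac{1+u q^n}{1-q^n}$ (so that $\sum_n f_n(k-1)q^n$ is the generating function of $(k,1)$-colored partitions), and write $f_n(u) = f_{n,0} + f_{n,1} u + \cdots + f_{n,t_n} u^{t_n}$ with $f_{n,t_n}\neq 0$. Then $\binom{t_n+1}{2} \le n < \binom{t_n+2}{2}$. Moreover: (1) $f_{n,i}$ is the number of overpartitions of $n$ in which exactly $i$ part sizes are overlined; (2) $f_{n,i} = \sum_{\lambda \vdash n} \binom{\ell_0(\lambda)}{i}$; (3) $f_n(u) = \sum_{\lambda \vdash n} (1+u)^{\ell_0(\lambda)}$, i.e. $f_n(k-1) = \sum_{\lambda \vdash n} k^{\ell_0(\lambda)}$; (4) $f_{n,i}$ is the number of partitions of $n-\binom{i+1}{2}$ in which each part of size at most $i$ may be of either of two colors (parts larger than $i$ have a single color).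
   Context: For a partition $\lambda$, $\ell_0(\lambda)$ denotes the number of distinct part sizes appearing in $\lambda$. An overpartition of $n$ is a partition of $n$ in which, for each part size, the last occurrence of that part may or may not be overlined. A $(k,1)$-colored partition is a partition in which each part is assigned one of $k$ colors, with all parts of a given size having the same color. -}

module Defs where

open import Data.Nat using (ℕ; zero; suc; _+_; _*_; _∸_; _^_; _≤_; _<_; _≡ᵇ_)
open import Data.Nat.Divisibility using (_∣?_)
open import Data.Nat.Combinatorics using (_C_)
open import Data.Bool using (Bool; true; false; if_then_else_; _∧_)
import Data.Bool as B
open import Data.Fin using (Fin)
open import Data.Nat.ListAction using (sum)
open import Data.List using (List; []; _∷_; map; length; deduplicate; allFin)
open import Data.List.Relation.Unary.All using (All)
open import Data.List.Relation.Unary.Linked using (Linked)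
open import Data.Product using (Σ; _×_; proj₁; proj₂; _,_)
open import Data.Sum using (_⊎_)
open import Data.Unit using (⊤)
open import Relation.Nullary.Decidable using (⌊_⌋)
open import Relation.Binary.PropositionalEquality using (_≡_)
open import Data.Nat.Properties using (_≟_)

sumTo : ℕ → (ℕ → ℕ) → ℕ
sumTo zero    g = g 0
sumTo (suc n) g = sumTo n g + g (suc n)

sumFin : (k : ℕ) → (Fin k → ℕ) → ℕ
sumFin k g = sum (map g (allFin k))

-- Bivariate formal power series in q and u with ℕ coefficients:
-- S n i = coefficient of q^n u^i.

Series : Set
Series = ℕ → ℕ → ℕ

one : Series
one n i = if (n ≡ᵇ 0) ∧ (i ≡ᵇ 0) then 1 else 0

_⊛_ : Series → Series → Series
(A ⊛ B) n i = sumTo n (λ a → sumTo i (λ b → A a b * B (n ∸ a) (i ∸ b)))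

numer : ℕ → Series
numer m n i = if ((n ≡ᵇ 0) ∧ (i ≡ᵇ 0)) B.∨ ((n ≡ᵇ m) ∧ (i ≡ᵇ 1)) then 1 else 0

-- 1 / (1 - q^m) = Σ_k q^{mk}   (used for m ≥ 1)
geom : ℕ → Series
geom m n i = if (i ≡ᵇ 0) ∧ ⌊ m ∣? n ⌋ then 1 else 0

prodTo : ℕ → Series
prodTo zero    = one
prodTo (suc N) = prodTo N ⊛ (numer (suc N) ⊛ geom (suc N))

-- Factors with m > n do not affect the coefficient of q^n, so the
-- truncation at N = n computes the coefficient of the infinite product.
f : ℕ → ℕ → ℕ
f n i = prodTo n n i

IsDegree : ℕ → ℕ → Set
IsDegree n t = (f n t ≡ 0 → Data.Empty.⊥) × (∀ i → t < i → f n i ≡ 0)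
  where import Data.Empty

-- value of f_n at u (f_n has degree ≤ n)
fEval : ℕ → ℕ → ℕ
fEval n u = sumTo n (λ i → f n i * u ^ i)

IsPartition : ℕ → List ℕ → Set
IsPartition n xs = All (λ x → 1 ≤ x) xs × Linked (λ a b → b ≤ a) xs × sum xs ≡ n

Partition : ℕ → Set
Partition n = Σ (List ℕ) (IsPartition n)

ℓ₀ : List ℕ → ℕ
ℓ₀ xs = length (deduplicate _≟_ xs)

-- Overpartitions: weakly decreasing list of (size, overlined?) pairs;
-- only the last occurrence of a size may be overlined.

OverLink : ℕ × Bool → ℕ × Bool → Set
OverLink (a , false) (b , _) = b ≤ a
OverLink (a , true)  (b , _) = b < a

IsOverpartition : ℕ → List (ℕ × Bool) → Set
IsOverpartition n xs =
  All (λ p → 1 ≤ proj₁ p) xs × Linked OverLink xs × sum (map proj₁ xs) ≡ n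

Overpartition : ℕ → Set
Overpartition n = Σ (List (ℕ × Bool)) (IsOverpartition n)

-- number of overlined parts (= number of overlined part sizes)
numOverlined : List (ℕ × Bool) → ℕ
numOverlined []               = 0
numOverlined ((_ , true) ∷ xs)  = suc (numOverlined xs)
numOverlined ((_ , false) ∷ xs) = numOverlined xs

-- Canonical order: sizes weakly decreasing; among equal sizes,
-- colour true before colour false.

ColourOK : ℕ → ℕ × Bool → Set
ColourOK i (a , false) = ⊤
ColourOK i (a , true)  = a ≤ i

ColLink : ℕ × Bool → ℕ × Bool → Set
ColLink (a , c) (b , d) = b < a ⊎ (b ≡ a × d B.≤ c)

IsTwoColPartition : ℕ → ℕ → List (ℕ × Bool) → Set
IsTwoColPartition i m xs =
  All (λ p → 1 ≤ proj₁ p) xs × All (ColourOK i) xs × Linked ColLink xs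
  × sum (map proj₁ xs) ≡ m

TwoColPartition : ℕ → ℕ → Set
TwoColPartition i m = Σ (List (ℕ × Bool)) (IsTwoColPartition i m)

module Submission where

-- Every statement is proved bijectively.  A coefficient of
-- a product of series is read as a set of objects: a bounded sum becomes a
-- Σ-type (sumTo↔), a Cauchy product a convolution of two such sets (⊛↔), and
-- the factor (1 + u q^m)/(1 - q^m) counts the parts of size m of an
-- overpartition (blockCount).  Induction on the number of factors then shows
-- that f n i counts overpartitions of n with i overlined parts: part (1).
-- Splitting an overpartition into its underlying partition and the choice of
-- overlined sizes gives part (2) with binomial(ℓ₀ λ, i) choices, and the
-- binomial theorem turns (2) into (3).  For (4), an overpartition is a pair
-- (i distinct overlined sizes, partition of plain sizes); removing the
-- staircase i, i-1, ..., 1 from the distinct sizes and conjugating yields a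
-- partition into parts ≤ i, i.e. the second colour.  The same decomposition
-- shows f n i = 0 for n < tri i, and the all-ones partition shows f n t ≠ 0
-- for the t with tri t ≤ n < tri (t + 1), which is therefore the degree.

open import Defs
open import Data.Nat using (ℕ; zero; suc; _+_; _*_; _^_; _∸_; _≤_; _<_; z≤n; s≤s; s≤s⁻¹; _≡ᵇ_; _<ᵇ_; _≤ᵇ_)
open import Data.Nat.Properties
open import Data.Nat.Combinatorics using (_C_; nCk+nC[k+1]≡[n+1]C[k+1]; nC1≡n)
open import Data.Nat.DivMod using (_/_; m*n/n≡m; m/n*n≡m)
open import Data.Nat.Divisibility using (_∣?_; divides)
open import Data.Nat.ListAction using (sum)
open import Data.Nat.ListAction.Properties using (sum-++)
open import Data.Nat.Tactic.RingSolver using (solve-∀)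
open import Data.Bool using (Bool; true; false; T; if_then_else_; _∧_; _∨_; f≤t; b≤b)
open import Data.Bool.Properties using (T-irrelevant; T-∧; T-∨)
import Data.Bool.Properties as B
open import Data.Fin as F using (Fin)
open import Data.Fin.Properties using (+↔⊎; *↔×)
open import Data.Fin.Permutation using (↔⇒≡)
open import Data.List using (List; []; _∷_; _++_; map; length; replicate; deduplicate; allFin)
open import Data.List.Properties
  using (map-++; map-tabulate; length-++; length-map; length-replicate; length-deduplicate;
         ≡-dec; ∷-injectiveˡ; ∷-injectiveʳ; filter-all; filter-reject; filter-idem)
open import Data.List.Relation.Unary.All as All using (All; []; _∷_)
open import Data.List.Relation.Unary.All.Properties using (++⁺; ++⁻ʳ; map⁺; map⁻; deduplicate⁺)
open import Data.List.Relation.Unary.Linked as Lk using (Linked; []; [-]; _∷_)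
import Data.List.Relation.Unary.Linked.Properties as LkP
open import Data.Product using (Σ; ∃; _×_; _,_; proj₁; proj₂)
open import Data.Product.Function.Dependent.Propositional using (Σ-↔)
open import Data.Product.Function.NonDependent.Propositional using (_×-↔_)
open import Data.Sum using (_⊎_; inj₁; inj₂)
open import Data.Sum.Function.Propositional using (_⊎-↔_)
open import Data.Unit using (⊤; tt)
open import Data.Empty using (⊥; ⊥-elim)
open import Function using (_∘_; id)
open import Function.Bundles using (_↔_; Inverse; mk↔ₛ′; Equivalence)
open import Function.Properties.Inverse using (↔-refl; ↔-sym; ↔-trans)
open import Relation.Binary.PropositionalEquality
open import Relation.Nullary using (Irrelevant; ¬_; yes; no; ¬?)
open import Relation.Nullary.Decidable using (⌊_⌋; toWitness; fromWitness)
import Axiom.UniquenessOfIdentityProofs as UIP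

Σ-cong : {A : Set} {X Y : A → Set} → (∀ a → X a ↔ Y a) → Σ A X ↔ Σ A Y
Σ-cong f = Σ-↔ ↔-refl (λ {a} → f a)

Fin-≡ : ∀ {a b} → a ≡ b → Fin a ↔ Fin b
Fin-≡ refl = ↔-refl

Fin-if : ∀ b → Fin (if b then 1 else 0) ↔ T b
Fin-if true  = mk↔ₛ′ (λ _ → tt) (λ _ → F.zero) (λ _ → refl) (λ { F.zero → refl ; (F.suc ()) })
Fin-if false = mk↔ₛ′ (λ ()) (λ ()) (λ ()) (λ ())

Fin-empty : ∀ {c} → (Fin c → ⊥) → c ≡ 0
Fin-empty {zero}  _ = refl
Fin-empty {suc c} h = ⊥-elim (h F.zero)

subtype-≡ : {A : Set} {P : A → Set} → (∀ x → Irrelevant (P x)) →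
            {u v : Σ A P} → proj₁ u ≡ proj₁ v → u ≡ v
subtype-≡ irr {a , p} {.a , q} refl = cong (a ,_) (irr a p q)

×-irrelevant : ∀ {A B : Set} → Irrelevant A → Irrelevant B → Irrelevant (A × B)
×-irrelevant ia ib (a , b) (a' , b') = cong₂ _,_ (ia a a') (ib b b')

-- Combinatorial meaning of the bounded sum sumTo n g = g 0 + ... + g n:
-- a choice of an index a ≤ n together with one of g a objects.
Below : ℕ → (ℕ → ℕ) → Set
Below n g = Σ ℕ (λ a → a ≤ n × Fin (g a))

Below-suc : ∀ n g → (Below n g ⊎ Fin (g (suc n))) ↔ Below (suc n) g
Below-suc n g = mk↔ₛ′ to from to-from from-to
  where
  view : ∀ {a} → a ≤ suc n → a ≤ n ⊎ a ≡ suc n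
  view p with m≤n⇒m<n∨m≡n p
  ... | inj₁ q = inj₁ (s≤s⁻¹ q)
  ... | inj₂ e = inj₂ e
  to : Below n g ⊎ Fin (g (suc n)) → Below (suc n) g
  to (inj₁ (a , p , x)) = a , m≤n⇒m≤1+n p , x
  to (inj₂ x) = suc n , ≤-refl , x
  from : Below (suc n) g → Below n g ⊎ Fin (g (suc n))
  from (a , p , x) with view p
  ... | inj₁ q = inj₁ (a , q , x)
  ... | inj₂ e = inj₂ (subst (λ z → Fin (g z)) e x)
  to-from : ∀ y → to (from y) ≡ y
  to-from (a , p , x) with view p
  ... | inj₁ q    = cong (λ r → a , r , x) (≤-irrelevant _ _)
  ... | inj₂ refl = cong (λ r → suc n , r , x) (≤-irrelevant _ _)
  from-to : ∀ x → from (to x) ≡ x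
  from-to (inj₁ (a , p , x)) with view (m≤n⇒m≤1+n p)
  ... | inj₁ q = cong (λ r → inj₁ (a , r , x)) (≤-irrelevant _ _)
  ... | inj₂ e = ⊥-elim (1+n≰n (subst (_≤ n) e p))
  from-to (inj₂ x) with view (≤-refl {suc n})
  ... | inj₁ q = ⊥-elim (1+n≰n q)
  ... | inj₂ e = cong (λ e → inj₂ (subst (λ z → Fin (g z)) e x)) (≡-irrelevant e refl)

sumTo↔ : ∀ n g → Fin (sumTo n g) ↔ Below n g
sumTo↔ zero g = mk↔ₛ′ (λ x → 0 , z≤n , x) (λ { (.0 , z≤n , x) → x })
                      (λ { (.0 , z≤n , x) → refl }) (λ _ → refl)
sumTo↔ (suc n) g = ↔-trans +↔⊎ (↔-trans (sumTo↔ n g ⊎-↔ ↔-refl) (Below-suc n g))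

-- Combinatorial meaning of the Cauchy product: a coefficient of A ⊛ B
-- counts a split (a , b) of the exponents together with an object
-- counted by A at (a , b) and one counted by B at the complement.
Convolution : (ℕ → ℕ → Set) → (ℕ → ℕ → Set) → ℕ → ℕ → Set
Convolution X Y n i =
  Σ ℕ λ a → a ≤ n × Σ ℕ λ b → b ≤ i × (X a b × Y (n ∸ a) (i ∸ b))

⊛↔ : ∀ {A B : Series} {X Y : ℕ → ℕ → Set} →
     (∀ a b → Fin (A a b) ↔ X a b) → (∀ a b → Fin (B a b) ↔ Y a b) →
     ∀ n i → Fin ((A ⊛ B) n i) ↔ Convolution X Y n i
⊛↔ A↔X B↔Y n i =
  ↔-trans (sumTo↔ n _) (Σ-cong λ a → ↔-refl ×-↔
    ↔-trans (sumTo↔ i _) (Σ-cong λ b → ↔-refl ×-↔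
      ↔-trans *↔× (A↔X a b ×-↔ B↔Y (n ∸ a) (i ∸ b))))

-- The parts of size m of an overpartition: k plain copies followed by an
-- optional overlined copy.  ovWeight/ovCount are the weight and the number
-- of overlined parts contributed by the optional copy.
ovWeight : Bool → ℕ → ℕ
ovWeight false m = 0
ovWeight true  m = m

ovCount : Bool → ℕ
ovCount false = 0
ovCount true  = 1

Block : ℕ → ℕ → ℕ → Set
Block m w o = Σ ℕ λ k → Σ Bool λ ov → (k * m + ovWeight ov m ≡ w) × (ovCount ov ≡ o)

Block-≡ : ∀ {m w o k k' ov ov'} {e₁ e₁' e₂ e₂'} → k ≡ k' → ov ≡ ov' →
          _≡_ {A = Block m w o} (k , ov , e₁ , e₂) (k' , ov' , e₁' , e₂')
Block-≡ {e₁ = e₁} {e₁'} {e₂} {e₂'} refl refl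
  rewrite ≡-irrelevant e₁ e₁' | ≡-irrelevant e₂ e₂' = refl

-- The boolean conditions behind the coefficients of 1 + u q^m and of
-- 1/(1 - q^m); by definition  numer m c d = if numerBit m c d then 1 else 0
-- and  geom m x y = if geomBit m x y then 1 else 0.
numerBit : ℕ → ℕ → ℕ → Bool
numerBit m c d = ((c ≡ᵇ 0) ∧ (d ≡ᵇ 0)) ∨ ((c ≡ᵇ m) ∧ (d ≡ᵇ 1))

geomBit : ℕ → ℕ → ℕ → Bool
geomBit m x y = (y ≡ᵇ 0) ∧ ⌊ m ∣? x ⌋

numerBit-cases : ∀ {m c d} → T (numerBit m c d) → (c ≡ 0 × d ≡ 0) ⊎ (c ≡ m × d ≡ 1)
numerBit-cases {m} {c} {d} t with Equivalence.to T-∨ t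
... | inj₁ u = inj₁ (≡ᵇ⇒≡ c 0 (proj₁ (Equivalence.to T-∧ u)) , ≡ᵇ⇒≡ d 0 (proj₂ (Equivalence.to T-∧ u)))
... | inj₂ u = inj₂ (≡ᵇ⇒≡ c m (proj₁ (Equivalence.to T-∧ u)) , ≡ᵇ⇒≡ d 1 (proj₂ (Equivalence.to T-∧ u)))

monomialFlag : ℕ → Bool
monomialFlag d = d ≡ᵇ 1

monomial-weight : ∀ {m c d} → T (numerBit m c d) → ovWeight (monomialFlag d) m ≡ c
monomial-weight {m} {c} {d} t with numerBit-cases {m} {c} {d} t
... | inj₁ (refl , refl) = refl
... | inj₂ (refl , refl) = refl

monomial-count : ∀ {m c d} → T (numerBit m c d) → ovCount (monomialFlag d) ≡ d
monomial-count {m} {c} {d} t with numerBit-cases {m} {c} {d} t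
... | inj₁ (refl , refl) = refl
... | inj₂ (refl , refl) = refl

Monomials : ℕ → ℕ → ℕ → Set
Monomials m = Convolution (λ c d → T (numerBit m c d)) (λ x y → T (geomBit m x y))

Monomials-≡ : ∀ {m w o c c' d d'} {p p' q q' s s' t t'} → c ≡ c' → d ≡ d' →
              _≡_ {A = Monomials m w o} (c , p , d , q , s , t) (c' , p' , d' , q' , s' , t')
Monomials-≡ {p = p} {p'} {q} {q'} {s} {s'} {t} {t'} refl refl
  rewrite ≤-irrelevant p p' | ≤-irrelevant q q' | T-irrelevant s s' | T-irrelevant t t' = refl

monomialsToBlock : ∀ N w o → Monomials (suc N) w o → Block (suc N) w o
monomialsToBlock N w o (c , c≤w , d , d≤o , tn , tg) =
  (w ∸ c) / m , monomialFlag d ,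
  (begin
    (w ∸ c) / m * m + ovWeight (monomialFlag d) m
      ≡⟨ cong₂ _+_ (m/n*n≡m (toWitness {a? = m ∣? (w ∸ c)} (proj₂ (Equivalence.to T-∧ tg))))
                   (monomial-weight {m} {c} {d} tn) ⟩
    w ∸ c + c
      ≡⟨ m∸n+n≡m c≤w ⟩
    w ∎) ,
  trans (monomial-count {m} {c} {d} tn)
        (≤-antisym d≤o (m∸n≡0⇒m≤n (≡ᵇ⇒≡ (o ∸ d) 0 (proj₁ (Equivalence.to T-∧ tg)))))
  where
  open ≡-Reasoning
  m = suc N

numerBit-flag : ∀ m ov → T (numerBit m (ovWeight ov m) (ovCount ov))
numerBit-flag m false = tt
numerBit-flag m true  = Equivalence.from T-∨ (inj₂ (Equivalence.from T-∧ (≡⇒≡ᵇ m m refl , tt)))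

plain-weight : ∀ {m w} k ov → k * m + ovWeight ov m ≡ w → w ∸ ovWeight ov m ≡ k * m
plain-weight {m} k ov refl = m+n∸n≡m (k * m) (ovWeight ov m)

blockToMonomials : ∀ N w o → Block (suc N) w o → Monomials (suc N) w o
blockToMonomials N w o (k , ov , e₁ , e₂) =
  ovWeight ov m , subst (ovWeight ov m ≤_) e₁ (m≤n+m (ovWeight ov m) (k * m)) ,
  ovCount ov , ≤-reflexive e₂ , numerBit-flag m ov ,
  Equivalence.from T-∧ (≡⇒≡ᵇ (o ∸ ovCount ov) 0 (trans (cong (o ∸_) e₂) (n∸n≡0 o)) ,
                        fromWitness (divides k (plain-weight k ov e₁)))
  where m = suc N

Monomials↔Block : ∀ N w o → Monomials (suc N) w o ↔ Block (suc N) w o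
Monomials↔Block N w o = mk↔ₛ′ (monomialsToBlock N w o) (blockToMonomials N w o) to-from from-to
  where
  flag-count : ∀ ov → monomialFlag (ovCount ov) ≡ ov
  flag-count false = refl
  flag-count true  = refl
  to-from : ∀ y → monomialsToBlock N w o (blockToMonomials N w o y) ≡ y
  to-from (k , ov , e₁ , e₂) =
    Block-≡ (trans (cong (_/ suc N) (plain-weight k ov e₁)) (m*n/n≡m k (suc N))) (flag-count ov)
  from-to : ∀ x → blockToMonomials N w o (monomialsToBlock N w o x) ≡ x
  from-to (c , c≤w , d , d≤o , tn , tg) =
    Monomials-≡ (monomial-weight {suc N} {c} {d} tn) (monomial-count {suc N} {c} {d} tn)

blockCount : ∀ N w o → Fin ((numer (suc N) ⊛ geom (suc N)) w o) ↔ Block (suc N) w o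
blockCount N w o =
  ↔-trans (⊛↔ (λ c d → Fin-if (numerBit (suc N) c d)) (λ x y → Fin-if (geomBit (suc N) x y)) w o)
          (Monomials↔Block N w o)

Tagged : Set
Tagged = ℕ × Bool

sizes⁺ : ∀ {P : ℕ → Set} {ys : List Tagged} → All (P ∘ proj₁) ys → All P (map proj₁ ys)
sizes⁺ = map⁺

sizes⁻ : ∀ {P : ℕ → Set} {ys : List Tagged} → All P (map proj₁ ys) → All (P ∘ proj₁) ys
sizes⁻ = map⁻

weight : List Tagged → ℕ
weight xs = sum (map proj₁ xs)

weight-++ : ∀ xs ys → weight (xs ++ ys) ≡ weight xs + weight ys
weight-++ xs ys = trans (cong sum (map-++ proj₁ xs ys)) (sum-++ (map proj₁ xs) (map proj₁ ys))

numOverlined-++ : ∀ xs ys → numOverlined (xs ++ ys) ≡ numOverlined xs + numOverlined ys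
numOverlined-++ [] ys = refl
numOverlined-++ ((a , true) ∷ xs) ys = cong suc (numOverlined-++ xs ys)
numOverlined-++ ((a , false) ∷ xs) ys = numOverlined-++ xs ys

InRange : ℕ → Tagged → Set
InRange N p = 1 ≤ proj₁ p × proj₁ p ≤ N

IsBoundedOver : ℕ → ℕ → ℕ → List Tagged → Set
IsBoundedOver N n i xs = All (InRange N) xs × Linked OverLink xs × weight xs ≡ n × numOverlined xs ≡ i

BoundedOver : ℕ → ℕ → ℕ → Set
BoundedOver N n i = Σ (List Tagged) (IsBoundedOver N n i)

OverLink-irrelevant : ∀ {x y} → Irrelevant (OverLink x y)
OverLink-irrelevant {a , false} = ≤-irrelevant
OverLink-irrelevant {a , true}  = <-irrelevant

IsBoundedOver-irrelevant : ∀ N n i xs → Irrelevant (IsBoundedOver N n i xs)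
IsBoundedOver-irrelevant N n i xs =
  ×-irrelevant (All.irrelevant (×-irrelevant ≤-irrelevant ≤-irrelevant))
   (×-irrelevant (Lk.irrelevant OverLink-irrelevant) (×-irrelevant ≡-irrelevant ≡-irrelevant))

BoundedOver-≡ : ∀ {N n i} {u v : BoundedOver N n i} → proj₁ u ≡ proj₁ v → u ≡ v
BoundedOver-≡ {N} {n} {i} = subtype-≡ (IsBoundedOver-irrelevant N n i)

empty-range : ∀ {p} → InRange 0 p → ⊥
empty-range (1≤s , s≤0) = 1+n≰n (≤-trans 1≤s s≤0)

BoundedOver-zero : ∀ n i → Fin (prodTo 0 n i) ↔ BoundedOver 0 n i
BoundedOver-zero zero zero =
  mk↔ₛ′ (λ _ → empty) (λ _ → F.zero) unique (λ { F.zero → refl ; (F.suc ()) })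
  where
  empty : BoundedOver 0 0 0
  empty = [] , [] , [] , refl , refl
  unique : ∀ y → empty ≡ y
  unique ([] , _) = BoundedOver-≡ refl
  unique (x ∷ _ , (p ∷ _) , _) = ⊥-elim (empty-range {x} p)
BoundedOver-zero zero (suc i) = mk↔ₛ′ (λ ()) (⊥-elim ∘ absurd) (⊥-elim ∘ absurd) (λ ())
  where
  absurd : BoundedOver 0 0 (suc i) → ⊥
  absurd ([] , _ , _ , _ , ())
  absurd (x ∷ _ , (p ∷ _) , _) = empty-range {x} p
BoundedOver-zero (suc n) i = mk↔ₛ′ (λ ()) (⊥-elim ∘ absurd) (⊥-elim ∘ absurd) (λ ())
  where
  absurd : BoundedOver 0 (suc n) i → ⊥
  absurd ([] , _ , _ , () , _)
  absurd (x ∷ _ , (p ∷ _) , _) = empty-range {x} p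

blockOf : ℕ → ℕ → Bool → List Tagged
blockOf m zero    false = []
blockOf m zero    true  = (m , true) ∷ []
blockOf m (suc k) ov    = (m , false) ∷ blockOf m k ov

weight-blockOf : ∀ m k ov → weight (blockOf m k ov) ≡ k * m + ovWeight ov m
weight-blockOf m zero    false = refl
weight-blockOf m zero    true  = +-identityʳ m
weight-blockOf m (suc k) ov    = trans (cong (m +_) (weight-blockOf m k ov)) (sym (+-assoc m _ _))

numOverlined-blockOf : ∀ m k ov → numOverlined (blockOf m k ov) ≡ ovCount ov
numOverlined-blockOf m zero    false = refl
numOverlined-blockOf m zero    true  = refl
numOverlined-blockOf m (suc k) ov    = numOverlined-blockOf m k ov

peel : ℕ → List Tagged → ℕ × Bool × List Tagged
peelHead : ℕ → ℕ → Bool → List Tagged → Bool → ℕ × Bool × List Tagged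
peel m [] = 0 , false , []
peel m ((s , o) ∷ xs) = peelHead m s o xs (s ≡ᵇ m)
peelHead m s o     xs false = 0 , false , (s , o) ∷ xs
peelHead m s true  xs true  = 0 , true , xs
peelHead m s false xs true  = suc (proj₁ (peel m xs)) , proj₂ (peel m xs)

plainCount : ℕ → List Tagged → ℕ
plainCount m xs = proj₁ (peel m xs)

endsOverlined : ℕ → List Tagged → Bool
endsOverlined m xs = proj₁ (proj₂ (peel m xs))

rest : ℕ → List Tagged → List Tagged
rest m xs = proj₂ (proj₂ (peel m xs))

blockOf-peel : ∀ m xs → blockOf m (plainCount m xs) (endsOverlined m xs) ++ rest m xs ≡ xs
blockOf-peel m [] = refl
blockOf-peel m ((s , o) ∷ xs) = go o (s ≡ᵇ m) (≡ᵇ⇒≡ s m)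
  where
  go : ∀ o b → (T b → s ≡ m) →
       let r = peelHead m s o xs b in blockOf m (proj₁ r) (proj₁ (proj₂ r)) ++ proj₂ (proj₂ r) ≡ (s , o) ∷ xs
  go o     false _   = refl
  go true  true  s≡m = cong (λ z → (z , true) ∷ xs) (sym (s≡m tt))
  go false true  s≡m = cong₂ (λ z w → (z , false) ∷ w) (sym (s≡m tt)) (blockOf-peel m xs)

≡ᵇ-refl : ∀ m → (m ≡ᵇ m) ≡ true
≡ᵇ-refl zero    = refl
≡ᵇ-refl (suc m) = ≡ᵇ-refl m

≤⇒≢ᵇsuc : ∀ {s N} → s ≤ N → (s ≡ᵇ suc N) ≡ false
≤⇒≢ᵇsuc z≤n     = refl
≤⇒≢ᵇsuc (s≤s p) = ≤⇒≢ᵇsuc p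

peel-blockOf : ∀ N k ov r → All (λ p → proj₁ p ≤ N) r →
               peel (suc N) (blockOf (suc N) k ov ++ r) ≡ (k , ov , r)
peel-blockOf N zero false [] _ = refl
peel-blockOf N zero false ((s , o) ∷ r) (s≤N ∷ _) rewrite ≤⇒≢ᵇsuc s≤N = refl
peel-blockOf N zero true r _ rewrite ≡ᵇ-refl N = refl
peel-blockOf N (suc k) ov r r≤N rewrite ≡ᵇ-refl N =
  cong (λ z → suc (proj₁ z) , proj₂ z) (peel-blockOf N k ov r r≤N)

link≤ : ∀ {x y} → OverLink x y → proj₁ y ≤ proj₁ x
link≤ {a , false} p = p
link≤ {a , true}  p = <⇒≤ p

linked-All≤ : ∀ {x xs} → Linked OverLink (x ∷ xs) → All (λ p → proj₁ p ≤ proj₁ x) xs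
linked-All≤ [-]     = []
linked-All≤ (r ∷ l) = link≤ r ∷ All.map (λ q → ≤-trans q (link≤ r)) (linked-All≤ l)

linked-All< : ∀ {s xs} → Linked OverLink ((s , true) ∷ xs) → All (λ p → proj₁ p < s) xs
linked-All< [-]     = []
linked-All< (r ∷ l) = r ∷ All.map (λ q → ≤-<-trans q r) (linked-All≤ l)

rest-bounded : ∀ N xs → All (λ p → proj₁ p ≤ suc N) xs → Linked OverLink xs →
               All (λ p → proj₁ p ≤ N) (rest (suc N) xs)
rest-bounded N [] _ _ = []
rest-bounded N ((s , o) ∷ xs) (s≤1+N ∷ xs≤1+N) l =
  go o (s ≡ᵇ suc N) (≡ᵇ⇒≡ s (suc N)) (≡⇒≡ᵇ s (suc N)) l
  where
  go : ∀ o b → (T b → s ≡ suc N) → (s ≡ suc N → T b) → Linked OverLink ((s , o) ∷ xs) →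
       All (λ p → proj₁ p ≤ N) (proj₂ (proj₂ (peelHead (suc N) s o xs b)))
  go o false _ s≢ l = s≤N ∷ All.map (λ q → ≤-trans q s≤N) (linked-All≤ l)
    where
    s≤N : s ≤ N
    s≤N = s≤s⁻¹ (≤∧≢⇒< s≤1+N s≢)
  go true  true s≡ _ l = All.map (λ q → s≤s⁻¹ (subst (_ <_) (s≡ tt) q)) (linked-All< l)
  go false true _  _ l = rest-bounded N xs xs≤1+N (Lk.tail l)

linked-++⁻ʳ : ∀ {A : Set} {R : A → A → Set} xs {ys} → Linked R (xs ++ ys) → Linked R ys
linked-++⁻ʳ []       l = l
linked-++⁻ʳ (x ∷ xs) l = linked-++⁻ʳ xs (Lk.tail l)

consPlain : ∀ {a xs} → All (λ p → proj₁ p ≤ a) xs → Linked OverLink xs → Linked OverLink ((a , false) ∷ xs)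
consPlain []      _ = [-]
consPlain (p ∷ _) l = p ∷ l

consOverlined : ∀ {a xs} → All (λ p → proj₁ p < a) xs → Linked OverLink xs → Linked OverLink ((a , true) ∷ xs)
consOverlined []      _ = [-]
consOverlined (p ∷ _) l = p ∷ l

blockOf-InRange : ∀ N k ov → All (InRange (suc N)) (blockOf (suc N) k ov)
blockOf-InRange N zero    false = []
blockOf-InRange N zero    true  = (s≤s z≤n , ≤-refl) ∷ []
blockOf-InRange N (suc k) ov    = (s≤s z≤n , ≤-refl) ∷ blockOf-InRange N k ov

blockOf-linked : ∀ N k ov r → All (λ p → proj₁ p ≤ N) r → Linked OverLink r →
                 Linked OverLink (blockOf (suc N) k ov ++ r)
blockOf-linked N zero    false r r≤N l = l
blockOf-linked N zero    true  r r≤N l = consOverlined (All.map s≤s r≤N) l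
blockOf-linked N (suc k) ov    r r≤N l =
  consPlain (++⁺ (All.map proj₂ (blockOf-InRange N k ov)) (All.map m≤n⇒m≤1+n r≤N))
            (blockOf-linked N k ov r r≤N l)

-- Going from the bound N to suc N: an overpartition with parts ≤ suc N is an
-- overpartition with parts ≤ N preceded by a block of parts of size suc N.
Layered : ℕ → ℕ → ℕ → Set
Layered N = Convolution (BoundedOver N) (Block (suc N))

Layered-≡ : ∀ {N n i a a' b b' xs xs' k k' ov ov'} {pa pa' pb pb' px px' e₁ e₁' e₂ e₂'} →
            a ≡ a' → b ≡ b' → xs ≡ xs' → k ≡ k' → ov ≡ ov' →
            _≡_ {A = Layered N n i} (a , pa , b , pb , (xs , px) , (k , ov , e₁ , e₂))
                                    (a' , pa' , b' , pb' , (xs' , px') , (k' , ov' , e₁' , e₂'))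
Layered-≡ {N} {n} {i} {a} {b = b} {xs = xs} {pa = pa} {pa'} {pb} {pb'} {px} {px'} {e₁} {e₁'} {e₂} {e₂'}
          refl refl refl refl refl
  rewrite ≤-irrelevant pa pa' | ≤-irrelevant pb pb' | IsBoundedOver-irrelevant N a b xs px px'
        | ≡-irrelevant e₁ e₁' | ≡-irrelevant e₂ e₂' = refl

attachBlock : ∀ N n i → Layered N n i → BoundedOver (suc N) n i
attachBlock N n i (a , a≤n , b , b≤i , (xs , inRange , linked , wt , ov) , (k , o , e₁ , e₂)) =
  blockOf m k o ++ xs ,
  ++⁺ (blockOf-InRange N k o) (All.map (λ (p , q) → p , m≤n⇒m≤1+n q) inRange) ,
  blockOf-linked N k o xs (All.map proj₂ inRange) linked ,
  trans (weight-++ (blockOf m k o) xs)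
        (trans (cong₂ _+_ (trans (weight-blockOf m k o) e₁) wt) (m∸n+n≡m a≤n)) ,
  trans (numOverlined-++ (blockOf m k o) xs)
        (trans (cong₂ _+_ (trans (numOverlined-blockOf m k o) e₂) ov) (m∸n+n≡m b≤i))
  where m = suc N

split-sum : ∀ {x y t} → x + y ≡ t → y ≤ t × x ≡ t ∸ y
split-sum {x} {y} refl = m≤n+m y x , sym (m+n∸n≡m x y)

detachBlock : ∀ N n i → BoundedOver (suc N) n i → Layered N n i
detachBlock N n i (xs , inRange , linked , wt , ov) =
  weight r , proj₁ W , numOverlined r , proj₁ V , (r , inRange-r , linked-r , refl , refl) ,
  (k , o , trans (sym (weight-blockOf m k o)) (proj₂ W) ,
           trans (sym (numOverlined-blockOf m k o)) (proj₂ V))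
  where
  m = suc N
  k = plainCount m xs
  o = endsOverlined m xs
  r = rest m xs
  split : blockOf m k o ++ r ≡ xs
  split = blockOf-peel m xs
  W : weight r ≤ n × weight (blockOf m k o) ≡ n ∸ weight r
  W = split-sum (trans (sym (weight-++ (blockOf m k o) r)) (trans (cong weight split) wt))
  V : numOverlined r ≤ i × numOverlined (blockOf m k o) ≡ i ∸ numOverlined r
  V = split-sum (trans (sym (numOverlined-++ (blockOf m k o) r)) (trans (cong numOverlined split) ov))
  inRange-r : All (InRange N) r
  inRange-r = All.zip (All.map proj₁ (++⁻ʳ (blockOf m k o) (subst (All (InRange m)) (sym split) inRange)) ,
                       rest-bounded N xs (All.map proj₂ inRange) linked)
  linked-r : Linked OverLink r
  linked-r = linked-++⁻ʳ (blockOf m k o) (subst (Linked OverLink) (sym split) linked)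

Layered↔BoundedOver : ∀ N n i → Layered N n i ↔ BoundedOver (suc N) n i
Layered↔BoundedOver N n i =
  mk↔ₛ′ (attachBlock N n i) (detachBlock N n i) (λ (xs , _) → BoundedOver-≡ (blockOf-peel (suc N) xs)) from-to
  where
  from-to : ∀ x → detachBlock N n i (attachBlock N n i x) ≡ x
  from-to (a , _ , b , _ , (xs , inRange , _ , wt , ov) , (k , o , _ , _)) =
    Layered-≡ (trans (cong (λ z → weight (proj₂ (proj₂ z))) peeled) wt)
              (trans (cong (λ z → numOverlined (proj₂ (proj₂ z))) peeled) ov)
              (cong (λ z → proj₂ (proj₂ z)) peeled) (cong proj₁ peeled) (cong (λ z → proj₁ (proj₂ z)) peeled)
    where
    peeled = peel-blockOf N k o xs (All.map proj₂ inRange)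

-- Coefficients of the truncated product prodTo N count overpartitions with
-- parts ≤ N, by induction on N: each new factor contributes one block.
prodTo↔ : ∀ N n i → Fin (prodTo N n i) ↔ BoundedOver N n i
prodTo↔ zero    n i = BoundedOver-zero n i
prodTo↔ (suc N) n i =
  ↔-trans (⊛↔ (prodTo↔ N) (blockCount N) n i) (Layered↔BoundedOver N n i)

OverWith : ℕ → ℕ → Set
OverWith n i = Σ (Overpartition n) (λ o → numOverlined (proj₁ o) ≡ i)

IsOverpartition-irrelevant : ∀ n xs → Irrelevant (IsOverpartition n xs)
IsOverpartition-irrelevant n xs =
  ×-irrelevant (All.irrelevant ≤-irrelevant) (×-irrelevant (Lk.irrelevant OverLink-irrelevant) ≡-irrelevant)

OverWith-≡ : ∀ {n i} {u v : OverWith n i} → proj₁ (proj₁ u) ≡ proj₁ (proj₁ v) → u ≡ v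
OverWith-≡ {n} {i} {(xs , p) , e} {(.xs , q) , e'} refl
  rewrite IsOverpartition-irrelevant n xs p q | ≡-irrelevant e e' = refl

-- No part exceeds the total weight, so the bound N = n is no restriction.
weight-bounds-parts : ∀ xs → All (λ p → proj₁ p ≤ weight xs) xs
weight-bounds-parts []       = []
weight-bounds-parts (x ∷ xs) =
  m≤m+n (proj₁ x) (weight xs) ∷ All.map (λ q → ≤-trans q (m≤n+m (weight xs) (proj₁ x))) (weight-bounds-parts xs)

BoundedOver↔OverWith : ∀ n i → BoundedOver n n i ↔ OverWith n i
BoundedOver↔OverWith n i = mk↔ₛ′ to from (λ _ → OverWith-≡ refl) (λ _ → BoundedOver-≡ refl)
  where
  to : BoundedOver n n i → OverWith n i
  to (xs , inRange , linked , wt , ov) = (xs , All.map proj₁ inRange , linked , wt) , ov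
  from : OverWith n i → BoundedOver n n i
  from ((xs , pos , linked , wt) , ov) =
    xs , All.zip (pos , subst (λ w → All (λ p → proj₁ p ≤ w) xs) wt (weight-bounds-parts xs)) , linked , wt , ov

f↔OverWith : ∀ n i → Fin (f n i) ↔ OverWith n i
f↔OverWith n i = ↔-trans (prodTo↔ n n i) (BoundedOver↔OverWith n i)

Overlining : List ℕ → ℕ → Set
Overlining lam i = Σ (List Tagged) (λ ys → (map proj₁ ys ≡ lam) × Linked OverLink ys × numOverlined ys ≡ i)

Overlining-≡ : ∀ {lam i} {u v : Overlining lam i} → proj₁ u ≡ proj₁ v → u ≡ v
Overlining-≡ {u = ys , a , b , c} {.ys , a' , b' , c'} refl
  rewrite UIP.Decidable⇒UIP.≡-irrelevant (≡-dec _≟_) a a'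
        | Lk.irrelevant OverLink-irrelevant b b' | ≡-irrelevant c c' = refl

IsPartition-irrelevant : ∀ n xs → Irrelevant (IsPartition n xs)
IsPartition-irrelevant n xs =
  ×-irrelevant (All.irrelevant ≤-irrelevant) (×-irrelevant (Lk.irrelevant ≤-irrelevant) ≡-irrelevant)

OverWith↔Overlining : ∀ n i → OverWith n i ↔ Σ (Partition n) (λ p → Overlining (proj₁ p) i)
OverWith↔Overlining n i = mk↔ₛ′ to from to-from (λ _ → OverWith-≡ refl)
  where
  to : OverWith n i → Σ (Partition n) (λ p → Overlining (proj₁ p) i)
  to ((xs , pos , linked , wt) , ov) =
    (map proj₁ xs , sizes⁺ pos , LkP.map⁺ (Lk.map link≤ linked) , wt) , (xs , refl , linked , ov)
  from : Σ (Partition n) (λ p → Overlining (proj₁ p) i) → OverWith n i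
  from ((lam , pos , _ , sum≡n) , (ys , refl , linked , ov)) = (ys , sizes⁻ pos , linked , sum≡n) , ov
  to-from : ∀ y → to (from y) ≡ y
  to-from ((.(map proj₁ ys) , p) , (ys , refl , linked , ov)) =
    cong (λ z → (map proj₁ ys , z) , (ys , refl , linked , ov)) (IsPartition-irrelevant n (map proj₁ ys) _ p)

overlining-[] : ∀ i → Overlining [] i ↔ Fin (0 C i)
overlining-[] zero = mk↔ₛ′ (λ _ → F.zero) (λ _ → [] , refl , [] , refl) (λ { F.zero → refl ; (F.suc ()) }) unique
  where
  unique : ∀ (y : Overlining [] 0) → ([] , refl , [] , refl) ≡ y
  unique ([] , _) = Overlining-≡ refl
  unique (_ ∷ _ , () , _)
overlining-[] (suc i) = mk↔ₛ′ (⊥-elim ∘ absurd) (λ ()) (λ ()) (⊥-elim ∘ absurd)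
  where
  absurd : Overlining [] (suc i) → ⊥
  absurd ([] , _ , _ , ())
  absurd (_ ∷ _ , () , _)

below-tail : ∀ {x lam} → All (_< x) lam → ∀ ys → map proj₁ ys ≡ lam → All (λ p → proj₁ p < x) ys
below-tail {x} lam<x ys eq = sizes⁻ (subst (All (_< x)) (sym eq) lam<x)

overlining-new-zero : ∀ x lam → All (_< x) lam → Overlining (x ∷ lam) 0 ↔ Overlining lam 0
overlining-new-zero x lam lam<x = mk↔ₛ′ to from (λ _ → Overlining-≡ refl) from-to
  where
  to : Overlining (x ∷ lam) 0 → Overlining lam 0
  to ([] , () , _)
  to ((a , true) ∷ ys , eq , linked , ())
  to ((a , false) ∷ ys , eq , linked , ov) = ys , ∷-injectiveʳ eq , Lk.tail linked , ov
  from : Overlining lam 0 → Overlining (x ∷ lam) 0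
  from (ys , eq , linked , ov) =
    (x , false) ∷ ys , cong (x ∷_) eq , consPlain (All.map <⇒≤ (below-tail lam<x ys eq)) linked , ov
  from-to : ∀ y → from (to y) ≡ y
  from-to ([] , () , _)
  from-to ((a , true) ∷ ys , eq , linked , ())
  from-to ((a , false) ∷ ys , eq , linked , ov) =
    Overlining-≡ (cong (λ z → (z , false) ∷ ys) (sym (∷-injectiveˡ eq)))

overlining-new-suc : ∀ x lam i → All (_< x) lam →
                     Overlining (x ∷ lam) (suc i) ↔ (Overlining lam i ⊎ Overlining lam (suc i))
overlining-new-suc x lam i lam<x = mk↔ₛ′ to from to-from from-to
  where
  to : Overlining (x ∷ lam) (suc i) → Overlining lam i ⊎ Overlining lam (suc i)
  to ([] , () , _)
  to ((a , true) ∷ ys , eq , linked , ov) = inj₁ (ys , ∷-injectiveʳ eq , Lk.tail linked , suc-injective ov)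
  to ((a , false) ∷ ys , eq , linked , ov) = inj₂ (ys , ∷-injectiveʳ eq , Lk.tail linked , ov)
  from : Overlining lam i ⊎ Overlining lam (suc i) → Overlining (x ∷ lam) (suc i)
  from (inj₁ (ys , eq , linked , ov)) =
    (x , true) ∷ ys , cong (x ∷_) eq , consOverlined (below-tail lam<x ys eq) linked , cong suc ov
  from (inj₂ (ys , eq , linked , ov)) =
    (x , false) ∷ ys , cong (x ∷_) eq , consPlain (All.map <⇒≤ (below-tail lam<x ys eq)) linked , ov
  to-from : ∀ y → to (from y) ≡ y
  to-from (inj₁ y) = cong inj₁ (Overlining-≡ refl)
  to-from (inj₂ y) = cong inj₂ (Overlining-≡ refl)
  from-to : ∀ y → from (to y) ≡ y
  from-to ([] , () , _)
  from-to ((a , true) ∷ ys , eq , linked , ov) = Overlining-≡ (cong (λ z → (z , true) ∷ ys) (sym (∷-injectiveˡ eq)))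
  from-to ((a , false) ∷ ys , eq , linked , ov) = Overlining-≡ (cong (λ z → (z , false) ∷ ys) (sym (∷-injectiveˡ eq)))

-- Only the last occurrence of a size may be overlined, so a repeated
-- leading part x is forced to be plain.
overlining-repeat : ∀ x lam i → All (_≤ x) lam → Overlining (x ∷ x ∷ lam) i ↔ Overlining (x ∷ lam) i
overlining-repeat x lam i lam≤x = mk↔ₛ′ to from (λ _ → Overlining-≡ refl) from-to
  where
  not-last : ∀ a ys → map proj₁ ((a , true) ∷ ys) ≡ x ∷ x ∷ lam → Linked OverLink ((a , true) ∷ ys) → ⊥
  not-last a [] () _
  not-last a (y ∷ ys) eq (r ∷ _) = <-irrefl (trans (∷-injectiveˡ (∷-injectiveʳ eq)) (sym (∷-injectiveˡ eq))) r
  to : Overlining (x ∷ x ∷ lam) i → Overlining (x ∷ lam) i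
  to ([] , () , _)
  to ((a , true) ∷ ys , eq , linked , ov) = ⊥-elim (not-last a ys eq linked)
  to ((a , false) ∷ ys , eq , linked , ov) = ys , ∷-injectiveʳ eq , Lk.tail linked , ov
  from : Overlining (x ∷ lam) i → Overlining (x ∷ x ∷ lam) i
  from (ys , eq , linked , ov) =
    (x , false) ∷ ys , cong (x ∷_) eq , consPlain (sizes⁻ (subst (All (_≤ x)) (sym eq) (≤-refl ∷ lam≤x))) linked , ov
  from-to : ∀ y → from (to y) ≡ y
  from-to ([] , () , _)
  from-to ((a , true) ∷ ys , eq , linked , ov) = ⊥-elim (not-last a ys eq linked)
  from-to ((a , false) ∷ ys , eq , linked , ov) = Overlining-≡ (cong (λ z → (z , false) ∷ ys) (sym (∷-injectiveˡ eq)))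

ℓ₀-repeat : ∀ x lam → ℓ₀ (x ∷ x ∷ lam) ≡ ℓ₀ (x ∷ lam)
ℓ₀-repeat x lam = cong (λ z → length (x ∷ z))
  (trans (filter-reject (¬? ∘ (x ≟_)) {x} (λ h → h refl))
         (filter-idem (¬? ∘ (x ≟_)) (deduplicate _≟_ lam)))

ℓ₀-new : ∀ x lam → All (_< x) lam → ℓ₀ (x ∷ lam) ≡ suc (ℓ₀ lam)
ℓ₀-new x lam lam<x = cong (λ z → suc (length z))
  (filter-all (¬? ∘ (x ≟_)) (deduplicate⁺ _≟_ (All.map (λ q e → <-irrefl (sym e) q) lam<x)))

WeaklyDecreasing : List ℕ → Set
WeaklyDecreasing = Linked (λ a b → b ≤ a)

StrictlyDecreasing : List ℕ → Set
StrictlyDecreasing = Linked (λ a b → b < a)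

decreasing-All≤ : ∀ {x xs} → WeaklyDecreasing (x ∷ xs) → All (_≤ x) xs
decreasing-All≤ [-]     = []
decreasing-All≤ (r ∷ l) = r ∷ All.map (λ q → ≤-trans q r) (decreasing-All≤ l)

-- Choosing which of the ℓ₀(λ) distinct sizes to overline:  there are
-- binomial(ℓ₀ λ, i) overlinings with i overlined parts.
overlining-count : ∀ lam → WeaklyDecreasing lam → ∀ i → Overlining lam i ↔ Fin (ℓ₀ lam C i)
overlining-count-new : ∀ x lam → All (_< x) lam → WeaklyDecreasing lam →
                       ∀ i → Overlining (x ∷ lam) i ↔ Fin (ℓ₀ (x ∷ lam) C i)
overlining-count [] _ i = overlining-[] i
overlining-count (x ∷ []) _ i = overlining-count-new x [] [] [] i
overlining-count (x ∷ y ∷ lam) (y≤x ∷ l) i with y ≟ x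
... | yes refl = ↔-trans (overlining-repeat x lam i (decreasing-All≤ l))
                   (↔-trans (overlining-count (x ∷ lam) l i) (Fin-≡ (cong (_C i) (sym (ℓ₀-repeat x lam)))))
... | no y≢x = overlining-count-new x (y ∷ lam) (y<x ∷ All.map (λ q → ≤-<-trans q y<x) (decreasing-All≤ l)) l i
  where
  y<x : y < x
  y<x = ≤∧≢⇒< y≤x y≢x
overlining-count-new x lam lam<x l zero =
  ↔-trans (overlining-new-zero x lam lam<x) (overlining-count lam l 0)
overlining-count-new x lam lam<x l (suc i) =
  ↔-trans (overlining-new-suc x lam i lam<x)
   (↔-trans (overlining-count lam l i ⊎-↔ overlining-count lam l (suc i))
     (↔-trans (↔-sym +↔⊎)
       (Fin-≡ (trans (nCk+nC[k+1]≡[n+1]C[k+1] (ℓ₀ lam) i) (cong (_C suc i) (sym (ℓ₀-new x lam lam<x)))))))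

sumFin-suc : ∀ k (g : Fin (suc k) → ℕ) → sumFin (suc k) g ≡ g F.zero + sumFin k (g ∘ F.suc)
sumFin-suc k g = cong (λ xs → g F.zero + sum xs)
  (trans (map-tabulate F.suc g) (sym (map-tabulate id (g ∘ F.suc))))

sumFin↔ : ∀ k g → Fin (sumFin k g) ↔ Σ (Fin k) (λ j → Fin (g j))
sumFin↔ zero    g = mk↔ₛ′ (λ ()) (λ { (() , _) }) (λ { (() , _) }) (λ ())
sumFin↔ (suc k) g =
  ↔-trans (Fin-≡ (sumFin-suc k g)) (↔-trans +↔⊎ (↔-trans (↔-refl ⊎-↔ sumFin↔ k (g ∘ F.suc)) first-or-later))
  where
  first-or-later : (Fin (g F.zero) ⊎ Σ (Fin k) (λ j → Fin (g (F.suc j)))) ↔ Σ (Fin (suc k)) (λ j → Fin (g j))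
  first-or-later =
    mk↔ₛ′ (λ { (inj₁ x) → F.zero , x ; (inj₂ (j , x)) → F.suc j , x })
          (λ { (F.zero , x) → inj₁ x ; (F.suc j , x) → inj₂ (j , x) })
          (λ { (F.zero , x) → refl ; (F.suc j , x) → refl })
          (λ { (inj₁ x) → refl ; (inj₂ (j , x)) → refl })

-- Part (2): f_{n,i} = Σ_{λ ⊢ n} binomial(ℓ₀ λ, i), for any enumeration of the
-- partitions of n.  Both sides count pairs (λ, overlining of λ with i bars).
f≡Σbinomial : ∀ n i k (e : Fin k ↔ Partition n) →
              f n i ≡ sumFin k (λ j → ℓ₀ (proj₁ (Inverse.to e j)) C i)
f≡Σbinomial n i k e = ↔⇒≡
  (↔-trans (f↔OverWith n i) (↔-trans (OverWith↔Overlining n i)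
   (↔-trans (Σ-cong λ (lam , _ , decreasing , _) → overlining-count lam decreasing i)
    (↔-trans (↔-sym (Σ-↔ e ↔-refl)) (↔-sym (sumFin↔ k _))))))

module _ {X : Set} where
  sum-map-+ : ∀ (L : List X) a b → sum (map (λ j → a j + b j) L) ≡ sum (map a L) + sum (map b L)
  sum-map-+ []      a b = refl
  sum-map-+ (x ∷ L) a b =
    trans (cong (a x + b x +_) (sum-map-+ L a b)) (+-+-interchange (a x) (b x) (sum (map a L)) (sum (map b L)))
    where
    +-+-interchange : ∀ p q r s → p + q + (r + s) ≡ p + r + (q + s)
    +-+-interchange = solve-∀

  sum-map-*ʳ : ∀ (L : List X) a c → sum (map (λ j → a j * c) L) ≡ sum (map a L) * c
  sum-map-*ʳ []      a c = refl
  sum-map-*ʳ (x ∷ L) a c = trans (cong (a x * c +_) (sum-map-*ʳ L a c)) (sym (*-distribʳ-+ c (a x) _))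

  sum-map-cong : ∀ (L : List X) {a b} → (∀ j → a j ≡ b j) → sum (map a L) ≡ sum (map b L)
  sum-map-cong []      h = refl
  sum-map-cong (x ∷ L) h = cong₂ _+_ (h x) (sum-map-cong L h)

sumTo-cong : ∀ n {g h : ℕ → ℕ} → (∀ i → g i ≡ h i) → sumTo n g ≡ sumTo n h
sumTo-cong zero    e = e 0
sumTo-cong (suc n) e = cong₂ _+_ (sumTo-cong n e) (e (suc n))

sumTo-sumFin : ∀ n k (G : ℕ → Fin k → ℕ) (c : ℕ → ℕ) →
  sumTo n (λ i → sumFin k (G i) * c i) ≡ sumFin k (λ j → sumTo n (λ i → G i j * c i))
sumTo-sumFin zero k G c = sym (sum-map-*ʳ (allFin k) (G 0) (c 0))
sumTo-sumFin (suc n) k G c =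
  trans (cong₂ _+_ (sumTo-sumFin n k G c) (sym (sum-map-*ʳ (allFin k) (G (suc n)) (c (suc n)))))
        (sym (sum-map-+ (allFin k) _ _))

module Binomial (u : ℕ) where
  binomialSum : ℕ → ℕ → ℕ
  binomialSum l N = sumTo N (λ i → (l C i) * u ^ i)

  pascal : ∀ l N → binomialSum (suc l) (suc N) ≡ binomialSum l (suc N) + u * binomialSum l N
  pascal l zero =
    trans (cong (λ z → 1 * 1 + z * u ^ 1) (sym (nCk+nC[k+1]≡[n+1]C[k+1] l 0))) (regroup (l C 1) u)
    where
    regroup : ∀ c u → 1 * 1 + (1 + c) * (u * 1) ≡ (1 * 1 + c * (u * 1)) + u * (1 * 1)
    regroup = solve-∀
  pascal l (suc N) =
    trans (cong₂ (λ a b → a + b * (u * u ^ suc N)) (pascal l N) (sym (nCk+nC[k+1]≡[n+1]C[k+1] l (suc N))))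
          (regroup (binomialSum l (suc N)) (binomialSum l N) (l C suc N) (l C suc (suc N)) u (u ^ suc N))
    where
    regroup : ∀ A B c₁ c₂ u p → (A + u * B) + (c₁ + c₂) * (u * p) ≡ (A + c₂ * (u * p)) + u * (B + c₁ * p)
    regroup = solve-∀

  binomialSum-zero : ∀ N → binomialSum 0 N ≡ 1
  binomialSum-zero zero = refl
  binomialSum-zero (suc N) rewrite binomialSum-zero N = refl

  binomial : ∀ l N → l ≤ N → binomialSum l N ≡ (1 + u) ^ l
  binomial zero    N       _       = binomialSum-zero N
  binomial (suc l) (suc N) (s≤s p) =
    trans (pascal l N) (cong₂ (λ a b → a + u * b) (binomial l (suc N) (m≤n⇒m≤1+n p)) (binomial l N p))

ℓ₀≤n : ∀ {n} (p : Partition n) → ℓ₀ (proj₁ p) ≤ n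
ℓ₀≤n (xs , pos , _ , sum≡n) =
  ≤-trans (length-deduplicate _≟_ xs) (subst (length xs ≤_) sum≡n (length≤sum pos))
  where
  length≤sum : ∀ {xs : List ℕ} → All (1 ≤_) xs → length xs ≤ sum xs
  length≤sum []       = z≤n
  length≤sum (p ∷ ps) = +-mono-≤ p (length≤sum ps)

fEval≡Σpower : ∀ n u k (e : Fin k ↔ Partition n) →
               fEval n u ≡ sumFin k (λ j → (1 + u) ^ ℓ₀ (proj₁ (Inverse.to e j)))
fEval≡Σpower n u k e =
  begin
    sumTo n (λ i → f n i * u ^ i)
      ≡⟨ sumTo-cong n (λ i → cong (_* u ^ i) (f≡Σbinomial n i k e)) ⟩
    sumTo n (λ i → sumFin k (λ j → ℓ j C i) * u ^ i)
      ≡⟨ sumTo-sumFin n k (λ i j → ℓ j C i) (u ^_) ⟩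
    sumFin k (λ j → Binomial.binomialSum u (ℓ j) n)
      ≡⟨ sum-map-cong (allFin k) (λ j → Binomial.binomial u (ℓ j) n (ℓ₀≤n (Inverse.to e j))) ⟩
    sumFin k (λ j → (1 + u) ^ ℓ j)
  ∎
  where
  open ≡-Reasoning
  ℓ : Fin k → ℕ
  ℓ j = ℓ₀ (proj₁ (Inverse.to e j))

trueSizes : List Tagged → List ℕ
trueSizes [] = []
trueSizes ((a , true)  ∷ xs) = a ∷ trueSizes xs
trueSizes ((a , false) ∷ xs) = trueSizes xs

falseSizes : List Tagged → List ℕ
falseSizes [] = []
falseSizes ((a , true)  ∷ xs) = falseSizes xs
falseSizes ((a , false) ∷ xs) = a ∷ falseSizes xs

weight-split : ∀ xs → weight xs ≡ sum (trueSizes xs) + sum (falseSizes xs)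
weight-split [] = refl
weight-split ((a , true)  ∷ xs) = trans (cong (a +_) (weight-split xs)) (sym (+-assoc a _ _))
weight-split ((a , false) ∷ xs) = trans (cong (a +_) (weight-split xs)) (move-left a (sum (trueSizes xs)) (sum (falseSizes xs)))
  where
  move-left : ∀ a t f → a + (t + f) ≡ t + (a + f)
  move-left = solve-∀

numOverlined-split : ∀ xs → numOverlined xs ≡ length (trueSizes xs)
numOverlined-split [] = refl
numOverlined-split ((a , true)  ∷ xs) = cong suc (numOverlined-split xs)
numOverlined-split ((a , false) ∷ xs) = numOverlined-split xs

All-trueSizes : ∀ {Q : Tagged → Set} {xs} → All Q xs → All (λ a → Q (a , true)) (trueSizes xs)
All-trueSizes {xs = []} [] = []
All-trueSizes {xs = (a , true)  ∷ xs} (q ∷ qs) = q ∷ All-trueSizes qs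
All-trueSizes {xs = (a , false) ∷ xs} (q ∷ qs) = All-trueSizes qs

All-falseSizes : ∀ {Q : Tagged → Set} {xs} → All Q xs → All (λ a → Q (a , false)) (falseSizes xs)
All-falseSizes {xs = []} [] = []
All-falseSizes {xs = (a , true)  ∷ xs} (q ∷ qs) = All-falseSizes qs
All-falseSizes {xs = (a , false) ∷ xs} (q ∷ qs) = q ∷ All-falseSizes qs

HeadSat : {A : Set} → (A → Set) → List A → Set
HeadSat Q []      = ⊤
HeadSat Q (y ∷ _) = Q y

cons-linked : ∀ {A : Set} {R : A → A → Set} {x ys} → HeadSat (R x) ys → Linked R ys → Linked R (x ∷ ys)
cons-linked {ys = []}    _ _ = [-]
cons-linked {ys = _ ∷ _} h l = h ∷ l

head-linked : ∀ {A : Set} {R : A → A → Set} {x ys} → Linked R (x ∷ ys) → HeadSat (R x) ys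
head-linked [-]     = tt
head-linked (r ∷ _) = r

HeadSat-map : ∀ {A : Set} {Q Q' : A → Set} L → (∀ {d} → Q d → Q' d) → HeadSat Q L → HeadSat Q' L
HeadSat-map []      g h = tt
HeadSat-map (_ ∷ _) g h = g h

HeadSat-trueSizes : ∀ {Q : Tagged → Set} {xs} → All Q xs → HeadSat (λ a → Q (a , true)) (trueSizes xs)
HeadSat-trueSizes {xs = []} [] = tt
HeadSat-trueSizes {xs = (a , true)  ∷ xs} (q ∷ qs) = q
HeadSat-trueSizes {xs = (a , false) ∷ xs} (q ∷ qs) = HeadSat-trueSizes qs

HeadSat-falseSizes : ∀ {Q : Tagged → Set} {xs} → All Q xs → HeadSat (λ a → Q (a , false)) (falseSizes xs)
HeadSat-falseSizes {xs = []} [] = tt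
HeadSat-falseSizes {xs = (a , true)  ∷ xs} (q ∷ qs) = HeadSat-falseSizes qs
HeadSat-falseSizes {xs = (a , false) ∷ xs} (q ∷ qs) = q

linked⇒All : ∀ {A : Set} {R : A → A → Set} → (∀ {x y z} → R x y → R y z → R x z) →
             ∀ {x xs} → Linked R (x ∷ xs) → All (R x) xs
linked⇒All tr [-]     = []
linked⇒All tr (r ∷ l) = r ∷ All.map (tr r) (linked⇒All tr l)

linked-trueSizes : ∀ {R : Tagged → Tagged → Set} → (∀ {x y z} → R x y → R y z → R x z) →
                   ∀ {xs} → Linked R xs → Linked (λ a b → R (a , true) (b , true)) (trueSizes xs)
linked-trueSizes tr {[]} l = []
linked-trueSizes tr {(a , true) ∷ xs} l =
  cons-linked (HeadSat-trueSizes (linked⇒All tr l)) (linked-trueSizes tr (Lk.tail l))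
linked-trueSizes tr {(a , false) ∷ xs} l = linked-trueSizes tr (Lk.tail l)

linked-falseSizes : ∀ {R : Tagged → Tagged → Set} → (∀ {x y z} → R x y → R y z → R x z) →
                    ∀ {xs} → Linked R xs → Linked (λ a b → R (a , false) (b , false)) (falseSizes xs)
linked-falseSizes tr {[]} l = []
linked-falseSizes tr {(a , true) ∷ xs} l = linked-falseSizes tr (Lk.tail l)
linked-falseSizes tr {(a , false) ∷ xs} l =
  cons-linked (HeadSat-falseSizes (linked⇒All tr l)) (linked-falseSizes tr (Lk.tail l))

if-elim : ∀ {A : Set} (Q : A → Set) c {x y} → (c ≡ true → Q x) → (c ≡ false → Q y) → Q (if c then x else y)
if-elim Q true  t _ = t refl
if-elim Q false _ f = f refl

-- Merging a list of true-tagged sizes with a list of false-tagged sizes,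
-- where cmp d p decides whether the true part d comes before the false part p.
-- Under ordering hypotheses, merge inverts the separation above.
module Merge (cmp : ℕ → ℕ → Bool) where
  merge : List ℕ → List ℕ → List Tagged
  merge []      []      = []
  merge []      (p ∷ P) = (p , false) ∷ merge [] P
  merge (d ∷ D) []      = (d , true) ∷ merge D []
  merge (d ∷ D) (p ∷ P) = if cmp d p then (d , true) ∷ merge D (p ∷ P) else (p , false) ∷ merge (d ∷ D) P

  merge-cons : ∀ (Q : List Tagged → Set) d D p P →
               (cmp d p ≡ true → Q ((d , true) ∷ merge D (p ∷ P))) →
               (cmp d p ≡ false → Q ((p , false) ∷ merge (d ∷ D) P)) → Q (merge (d ∷ D) (p ∷ P))
  merge-cons Q d D p P = if-elim Q (cmp d p)

  trueSizes-merge : ∀ D P → trueSizes (merge D P) ≡ D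
  trueSizes-merge []      []      = refl
  trueSizes-merge []      (p ∷ P) = trueSizes-merge [] P
  trueSizes-merge (d ∷ D) []      = cong (d ∷_) (trueSizes-merge D [])
  trueSizes-merge (d ∷ D) (p ∷ P) = merge-cons (λ ys → trueSizes ys ≡ d ∷ D) d D p P
    (λ _ → cong (d ∷_) (trueSizes-merge D (p ∷ P))) (λ _ → trueSizes-merge (d ∷ D) P)

  falseSizes-merge : ∀ D P → falseSizes (merge D P) ≡ P
  falseSizes-merge []      []      = refl
  falseSizes-merge []      (p ∷ P) = cong (p ∷_) (falseSizes-merge [] P)
  falseSizes-merge (d ∷ D) []      = falseSizes-merge D []
  falseSizes-merge (d ∷ D) (p ∷ P) = merge-cons (λ ys → falseSizes ys ≡ p ∷ P) d D p P
    (λ _ → falseSizes-merge D (p ∷ P)) (λ _ → cong (p ∷_) (falseSizes-merge (d ∷ D) P))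

  All-merge : ∀ {Q : Tagged → Set} D P → All (λ a → Q (a , true)) D → All (λ a → Q (a , false)) P →
              All Q (merge D P)
  All-merge []      []      _        _        = []
  All-merge []      (p ∷ P) qD       (q ∷ qP) = q ∷ All-merge [] P qD qP
  All-merge (d ∷ D) []      (q ∷ qD) qP       = q ∷ All-merge D [] qD qP
  All-merge {Q} (d ∷ D) (p ∷ P) (q ∷ qD) (q' ∷ qP) = merge-cons (All Q) d D p P
    (λ _ → q ∷ All-merge D (p ∷ P) qD (q' ∷ qP)) (λ _ → q' ∷ All-merge (d ∷ D) P (q ∷ qD) qP)

  HeadSat-merge : ∀ {Q : Tagged → Set} D P → HeadSat (λ a → Q (a , true)) D → HeadSat (λ a → Q (a , false)) P →
                  HeadSat Q (merge D P)
  HeadSat-merge []      []      _ _  = tt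
  HeadSat-merge []      (p ∷ P) _ h  = h
  HeadSat-merge (d ∷ D) []      h _  = h
  HeadSat-merge {Q} (d ∷ D) (p ∷ P) h h' = merge-cons (HeadSat Q) d D p P (λ _ → h) (λ _ → h')

  module _ {R : Tagged → Tagged → Set}
           (before : ∀ d p → cmp d p ≡ true → R (d , true) (p , false))
           (after  : ∀ d p → cmp d p ≡ false → R (p , false) (d , true)) where
    merge-linked : ∀ D P → Linked (λ a b → R (a , true) (b , true)) D → Linked (λ a b → R (a , false) (b , false)) P →
                   Linked R (merge D P)
    merge-linked []      []      _  _  = []
    merge-linked []      (p ∷ P) _  lP =
      cons-linked (HeadSat-merge [] P tt (head-linked lP)) (merge-linked [] P [] (Lk.tail lP))
    merge-linked (d ∷ D) []      lD _  =
      cons-linked (HeadSat-merge D [] (head-linked lD) tt) (merge-linked D [] (Lk.tail lD) [])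
    merge-linked (d ∷ D) (p ∷ P) lD lP = merge-cons (Linked R) d D p P
      (λ eq → cons-linked (HeadSat-merge D (p ∷ P) (head-linked lD) (before d p eq))
                          (merge-linked D (p ∷ P) (Lk.tail lD) lP))
      (λ eq → cons-linked (HeadSat-merge (d ∷ D) P (after d p eq) (head-linked lP))
                          (merge-linked (d ∷ D) P lD (Lk.tail lP)))

  merge-true : ∀ a D P → HeadSat (λ p → cmp a p ≡ true) P → merge (a ∷ D) P ≡ (a , true) ∷ merge D P
  merge-true a D []      h = refl
  merge-true a D (p ∷ P) h rewrite h = refl

  merge-false : ∀ p D P → HeadSat (λ d → cmp d p ≡ false) D → merge D (p ∷ P) ≡ (p , false) ∷ merge D P
  merge-false p []      P h = refl
  merge-false p (d ∷ D) P h rewrite h = refl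

  module _ {S : Tagged → Tagged → Set} (tr : ∀ {x y z} → S x y → S y z → S x z)
           (true-first  : ∀ {d p} → S (d , true) (p , false) → cmp d p ≡ true)
           (false-first : ∀ {d p} → S (p , false) (d , true) → cmp d p ≡ false) where
    merge-split : ∀ xs → Linked S xs → merge (trueSizes xs) (falseSizes xs) ≡ xs
    merge-split [] _ = refl
    merge-split ((a , true) ∷ xs) l =
      trans (merge-true a (trueSizes xs) (falseSizes xs)
               (HeadSat-map (falseSizes xs) true-first (HeadSat-falseSizes (linked⇒All tr l))))
            (cong ((a , true) ∷_) (merge-split xs (Lk.tail l)))
    merge-split ((a , false) ∷ xs) l =
      trans (merge-false a (trueSizes xs) (falseSizes xs)
               (HeadSat-map (trueSizes xs) false-first (HeadSat-trueSizes (linked⇒All tr l))))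
            (cong ((a , false) ∷_) (merge-split xs (Lk.tail l)))

Pairs : (List ℕ → Set) → (List ℕ → Set) → ℕ → Set
Pairs A B n = Σ (List ℕ × List ℕ) (λ (X , Y) → A X × B Y × sum X + sum Y ≡ n)

Pairs-≡ : ∀ {A B : List ℕ → Set} → (∀ X → Irrelevant (A X)) → (∀ Y → Irrelevant (B Y)) →
          ∀ {n} {u v : Pairs A B n} → proj₁ u ≡ proj₁ v → u ≡ v
Pairs-≡ irrA irrB = subtype-≡ (λ (X , Y) → ×-irrelevant (irrA X) (×-irrelevant (irrB Y) ≡-irrelevant))

Decreasing : List ℕ → Set
Decreasing P = WeaklyDecreasing P × All (1 ≤_) P

Distinct : ℕ → List ℕ → Set
Distinct i D = StrictlyDecreasing D × All (1 ≤_) D × length D ≡ i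

PartsAtMost : ℕ → List ℕ → Set
PartsAtMost i Q = WeaklyDecreasing Q × All (λ q → 1 ≤ q × q ≤ i) Q

Decreasing-irrelevant : ∀ P → Irrelevant (Decreasing P)
Decreasing-irrelevant P = ×-irrelevant (Lk.irrelevant ≤-irrelevant) (All.irrelevant ≤-irrelevant)

Distinct-irrelevant : ∀ i D → Irrelevant (Distinct i D)
Distinct-irrelevant i D =
  ×-irrelevant (Lk.irrelevant <-irrelevant) (×-irrelevant (All.irrelevant ≤-irrelevant) ≡-irrelevant)

PartsAtMost-irrelevant : ∀ i Q → Irrelevant (PartsAtMost i Q)
PartsAtMost-irrelevant i Q =
  ×-irrelevant (Lk.irrelevant ≤-irrelevant) (All.irrelevant (×-irrelevant ≤-irrelevant ≤-irrelevant))

≡true : ∀ {b} → T b → b ≡ true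
≡true {true} _ = refl

≡false : ∀ {b} → ¬ T b → b ≡ false
≡false {true}  h = ⊥-elim (h tt)
≡false {false} _ = refl

T-≡true : ∀ {b} → b ≡ true → T b
T-≡true refl = tt

-- The order of an overpartition as a transitive relation on tagged parts:
-- larger sizes first, and among equal sizes the overlined one last.
data OverOrder : Tagged → Tagged → Set where
  smaller : ∀ {a b o o'} → b < a → OverOrder (a , o) (b , o')
  same    : ∀ {a o} → OverOrder (a , false) (a , o)

OverOrder-trans : ∀ {x y z} → OverOrder x y → OverOrder y z → OverOrder x z
OverOrder-trans (smaller p) (smaller q) = smaller (<-trans q p)
OverOrder-trans (smaller p) same        = smaller p
OverOrder-trans same        (smaller q) = smaller q
OverOrder-trans same        same        = same

OverLink⇒OverOrder : ∀ {x y} → OverLink x y → OverOrder x y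
OverLink⇒OverOrder {a , true}  p = smaller p
OverLink⇒OverOrder {a , false} p with m≤n⇒m<n∨m≡n p
... | inj₁ q    = smaller q
... | inj₂ refl = same

-- An overpartition with i overlined parts is the pair (overlined sizes,
-- plain sizes): i distinct sizes and an arbitrary partition.
module OverMerge = Merge (λ d p → p <ᵇ d)

-- The separation into (overlined sizes, plain sizes) is inverted by merging,
-- overlined part d going first exactly when it is larger than the plain part p.
OverWith↔Pairs : ∀ n i → OverWith n i ↔ Pairs (Distinct i) Decreasing n
OverWith↔Pairs n i = mk↔ₛ′ to from to-from from-to
  where
  order : ∀ {xs} → Linked OverLink xs → Linked OverOrder xs
  order = Lk.map OverLink⇒OverOrder
  to : OverWith n i → Pairs (Distinct i) Decreasing n
  to ((xs , pos , linked , wt) , ov) =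
    (trueSizes xs , falseSizes xs) ,
    (Lk.map (λ { (smaller x) → x }) (linked-trueSizes OverOrder-trans (order linked)) ,
     All-trueSizes pos , trans (sym (numOverlined-split xs)) ov) ,
    (Lk.map (λ { (smaller x) → <⇒≤ x ; same → ≤-refl }) (linked-falseSizes OverOrder-trans (order linked)) ,
     All-falseSizes pos) ,
    trans (sym (weight-split xs)) wt
  before : ∀ d p → (p <ᵇ d) ≡ true → p < d
  before d p eq = <ᵇ⇒< p d (T-≡true eq)
  after : ∀ d p → (p <ᵇ d) ≡ false → d ≤ p
  after d p eq = ≮⇒≥ (λ lt → subst T eq (<⇒<ᵇ lt))
  from : Pairs (Distinct i) Decreasing n → OverWith n i
  from ((D , P) , (lD , posD , len) , (lP , posP) , e) =
    (OverMerge.merge D P , OverMerge.All-merge D P posD posP ,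
     OverMerge.merge-linked {R = OverLink} before after D P lD lP ,
     trans (weight-split (OverMerge.merge D P))
           (trans (cong₂ (λ a b → sum a + sum b) (OverMerge.trueSizes-merge D P) (OverMerge.falseSizes-merge D P)) e)) ,
    trans (numOverlined-split (OverMerge.merge D P)) (trans (cong length (OverMerge.trueSizes-merge D P)) len)
  to-from : ∀ y → to (from y) ≡ y
  to-from ((D , P) , _) = Pairs-≡ (Distinct-irrelevant i) Decreasing-irrelevant
                            (cong₂ _,_ (OverMerge.trueSizes-merge D P) (OverMerge.falseSizes-merge D P))
  true-first : ∀ {d p} → OverOrder (d , true) (p , false) → (p <ᵇ d) ≡ true
  true-first (smaller lt) = ≡true (<⇒<ᵇ lt)
  false-first : ∀ {d p} → OverOrder (p , false) (d , true) → (p <ᵇ d) ≡ false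
  false-first {d} {p} s = ≡false (λ t → <⇒≱ (<ᵇ⇒< p d t) (d≤p s))
    where
    d≤p : OverOrder (p , false) (d , true) → d ≤ p
    d≤p (smaller x) = <⇒≤ x
    d≤p same        = ≤-refl
  from-to : ∀ x → from (to x) ≡ x
  from-to ((xs , _ , linked , _) , _) =
    OverWith-≡ (OverMerge.merge-split OverOrder-trans true-first false-first xs (order linked))

ColLink-trans : ∀ {x y z} → ColLink x y → ColLink y z → ColLink x z
ColLink-trans (inj₁ p) (inj₁ q) = inj₁ (<-trans q p)
ColLink-trans {a , _} (inj₁ p) (inj₂ (e , _)) = inj₁ (subst (_< a) (sym e) p)
ColLink-trans {z = c , _} (inj₂ (e , _)) (inj₁ q) = inj₁ (subst (c <_) e q)
ColLink-trans (inj₂ (e , f)) (inj₂ (e' , f')) = inj₂ (trans e' e , B.≤-trans f' f)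

≤⇒ColLink : ∀ {a b c} → b ≤ a → ColLink (a , c) (b , c)
≤⇒ColLink p with m≤n⇒m<n∨m≡n p
... | inj₁ q = inj₁ q
... | inj₂ e = inj₂ (e , B.≤-refl)

ColLink⇒≤ : ∀ {a b c d} → ColLink (a , c) (b , d) → b ≤ a
ColLink⇒≤ (inj₁ q) = <⇒≤ q
ColLink⇒≤ (inj₂ (e , _)) = ≤-reflexive e

ColLink-irrelevant : ∀ {x y} → Irrelevant (ColLink x y)
ColLink-irrelevant (inj₁ p) (inj₁ q) = cong inj₁ (<-irrelevant p q)
ColLink-irrelevant (inj₁ p) (inj₂ (e , _)) = ⊥-elim (<-irrefl e p)
ColLink-irrelevant (inj₂ (e , _)) (inj₁ p) = ⊥-elim (<-irrefl e p)
ColLink-irrelevant (inj₂ p) (inj₂ q) = cong inj₂ (×-irrelevant ≡-irrelevant B.≤-irrelevant p q)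

ColourOK-irrelevant : ∀ {i x} → Irrelevant (ColourOK i x)
ColourOK-irrelevant {i} {a , false} _ _ = refl
ColourOK-irrelevant {i} {a , true}      = ≤-irrelevant

IsTwoColPartition-irrelevant : ∀ i m xs → Irrelevant (IsTwoColPartition i m xs)
IsTwoColPartition-irrelevant i m xs =
  ×-irrelevant (All.irrelevant ≤-irrelevant)
   (×-irrelevant (All.irrelevant (λ {x} → ColourOK-irrelevant {i} {x}))
     (×-irrelevant (Lk.irrelevant ColLink-irrelevant) ≡-irrelevant))

-- A two-coloured partition is the pair (sizes of colour true, sizes of colour
-- false): a partition into parts ≤ i and an arbitrary partition.
module ColourMerge = Merge (λ q p → p ≤ᵇ q)

-- The colour-true part q goes before the colour-false part p exactly when p ≤ q.
TwoColPartition↔Pairs : ∀ i m → TwoColPartition i m ↔ Pairs (PartsAtMost i) Decreasing m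
TwoColPartition↔Pairs i m = mk↔ₛ′ to from to-from from-to
  where
  to : TwoColPartition i m → Pairs (PartsAtMost i) Decreasing m
  to (xs , pos , colours , linked , wt) =
    (trueSizes xs , falseSizes xs) ,
    (Lk.map ColLink⇒≤ (linked-trueSizes ColLink-trans linked) , All.zip (All-trueSizes pos , All-trueSizes colours)) ,
    (Lk.map ColLink⇒≤ (linked-falseSizes ColLink-trans linked) , All-falseSizes pos) ,
    trans (sym (weight-split xs)) wt
  before : ∀ q p → (p ≤ᵇ q) ≡ true → ColLink (q , true) (p , false)
  before q p eq with m≤n⇒m<n∨m≡n (≤ᵇ⇒≤ p q (T-≡true eq))
  ... | inj₁ x = inj₁ x
  ... | inj₂ x = inj₂ (x , f≤t)
  after : ∀ q p → (p ≤ᵇ q) ≡ false → ColLink (p , false) (q , true)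
  after q p eq = inj₁ (≰⇒> (λ le → subst T eq (≤⇒≤ᵇ le)))
  plain : ∀ (P : List ℕ) → All (λ _ → ⊤) P
  plain []      = []
  plain (_ ∷ P) = tt ∷ plain P
  from : Pairs (PartsAtMost i) Decreasing m → TwoColPartition i m
  from ((Q , P) , (lQ , boundsQ) , (lP , posP) , e) =
    ColourMerge.merge Q P , ColourMerge.All-merge Q P (All.map proj₁ boundsQ) posP ,
    ColourMerge.All-merge Q P (All.map proj₂ boundsQ) (plain P) ,
    ColourMerge.merge-linked {R = ColLink} before after Q P (Lk.map ≤⇒ColLink lQ) (Lk.map ≤⇒ColLink lP) ,
    trans (weight-split (ColourMerge.merge Q P))
          (trans (cong₂ (λ a b → sum a + sum b) (ColourMerge.trueSizes-merge Q P) (ColourMerge.falseSizes-merge Q P)) e)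
  to-from : ∀ y → to (from y) ≡ y
  to-from ((Q , P) , _) = Pairs-≡ (PartsAtMost-irrelevant i) Decreasing-irrelevant
                            (cong₂ _,_ (ColourMerge.trueSizes-merge Q P) (ColourMerge.falseSizes-merge Q P))
  true-first : ∀ {d p} → ColLink (d , true) (p , false) → (p ≤ᵇ d) ≡ true
  true-first s = ≡true (≤⇒≤ᵇ (ColLink⇒≤ s))
  false-first : ∀ {d p} → ColLink (p , false) (d , true) → (p ≤ᵇ d) ≡ false
  false-first {d} {p} (inj₁ lt) = ≡false (λ t → <⇒≱ lt (≤ᵇ⇒≤ p d t))
  false-first (inj₂ (_ , ()))
  from-to : ∀ x → from (to x) ≡ x
  from-to (xs , p) = subtype-≡ (IsTwoColPartition-irrelevant i m)
    (ColourMerge.merge-split ColLink-trans true-first false-first xs (proj₁ (proj₂ (proj₂ p))))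

-- Triangular numbers  tri j = binomial(j + 1, 2) = 1 + 2 + ... + j.
tri : ℕ → ℕ
tri j = suc j C 2

tri-suc : ∀ j → tri (suc j) ≡ tri j + suc j
tri-suc j = trans (sym (nCk+nC[k+1]≡[n+1]C[k+1] (suc j) 1))
                  (trans (cong (_+ tri j) (nC1≡n (suc j))) (+-comm (suc j) (tri j)))

-- Subtracting the staircase (i, i-1, ..., 1) from i
-- distinct parts d₁ > ... > dᵢ ≥ 1 leaves a partition into at most i parts;
-- its conjugate is a partition into parts ≤ i.  removeStaircase computes this
-- conjugate directly: the gap d₁ - 1 - d₂ becomes that many parts 1, and all
-- parts coming from d₂ > ... > dᵢ grow by one.
headOr0 : List ℕ → ℕ
headOr0 []      = 0
headOr0 (x ∷ _) = x

removeStaircase : List ℕ → List ℕ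
removeStaircase [] = []
removeStaircase (s ∷ D) = map suc (removeStaircase D) ++ replicate (s ∸ suc (headOr0 D)) 1

splitOnes : List ℕ → List ℕ × ℕ
splitOnes []                = [] , 0
splitOnes (zero ∷ Q)        = splitOnes Q
splitOnes (suc zero ∷ Q)    = proj₁ (splitOnes Q) , suc (proj₂ (splitOnes Q))
splitOnes (suc (suc q) ∷ Q) = suc q ∷ proj₁ (splitOnes Q) , proj₂ (splitOnes Q)

-- The inverse: the ones of Q give the gap below the largest part, the
-- remaining parts lowered by one determine the smaller distinct parts.
addStaircase : ℕ → List ℕ → List ℕ
addStaircase zero    Q = []
addStaircase (suc i) Q =
  suc (proj₂ (splitOnes Q) + headOr0 (addStaircase i (proj₁ (splitOnes Q)))) ∷ addStaircase i (proj₁ (splitOnes Q))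

cons-decreasing : ∀ {x ys} → All (_≤ x) ys → WeaklyDecreasing ys → WeaklyDecreasing (x ∷ ys)
cons-decreasing []      _ = [-]
cons-decreasing (p ∷ _) l = p ∷ l

All-replicate : ∀ {P : ℕ → Set} g {x} → P x → All P (replicate g x)
All-replicate zero    p = []
All-replicate (suc g) p = p ∷ All-replicate g p

splitOnes-join : ∀ A g → All (1 ≤_) A → splitOnes (map suc A ++ replicate g 1) ≡ (A , g)
splitOnes-join [] zero _ = refl
splitOnes-join [] (suc g) _ rewrite splitOnes-join [] g [] = refl
splitOnes-join (suc a ∷ A) g (_ ∷ pos) rewrite splitOnes-join A g pos = refl

splitOnes-ones : ∀ Q → All (_≤ 1) Q → proj₁ (splitOnes Q) ≡ []
splitOnes-ones [] _ = refl
splitOnes-ones (zero ∷ Q)        (_ ∷ a) = splitOnes-ones Q a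
splitOnes-ones (suc zero ∷ Q)    (_ ∷ a) = splitOnes-ones Q a
splitOnes-ones (suc (suc q) ∷ Q) (s≤s () ∷ _)

join-splitOnes : ∀ Q → WeaklyDecreasing Q → All (1 ≤_) Q →
                 map suc (proj₁ (splitOnes Q)) ++ replicate (proj₂ (splitOnes Q)) 1 ≡ Q
join-splitOnes [] _ _ = refl
join-splitOnes (suc zero ∷ Q) l (_ ∷ pos)
  with proj₁ (splitOnes Q) | splitOnes-ones Q (decreasing-All≤ l) | join-splitOnes Q (Lk.tail l) pos
... | .[] | refl | e = cong (1 ∷_) e
join-splitOnes (suc (suc q) ∷ Q) l (_ ∷ pos) = cong (suc (suc q) ∷_) (join-splitOnes Q (Lk.tail l) pos)

splitOnes-positive : ∀ Q → All (1 ≤_) (proj₁ (splitOnes Q))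
splitOnes-positive [] = []
splitOnes-positive (zero ∷ Q)        = splitOnes-positive Q
splitOnes-positive (suc zero ∷ Q)    = splitOnes-positive Q
splitOnes-positive (suc (suc q) ∷ Q) = s≤s z≤n ∷ splitOnes-positive Q

splitOnes-bounded : ∀ b Q → All (_≤ suc b) Q → All (_≤ b) (proj₁ (splitOnes Q))
splitOnes-bounded b [] _ = []
splitOnes-bounded b (zero ∷ Q)        (_ ∷ a) = splitOnes-bounded b Q a
splitOnes-bounded b (suc zero ∷ Q)    (_ ∷ a) = splitOnes-bounded b Q a
splitOnes-bounded b (suc (suc q) ∷ Q) (s≤s p ∷ a) = p ∷ splitOnes-bounded b Q a

splitOnes-decreasing : ∀ Q → WeaklyDecreasing Q → WeaklyDecreasing (proj₁ (splitOnes Q))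
splitOnes-decreasing [] _ = []
splitOnes-decreasing (zero ∷ Q)        l = splitOnes-decreasing Q (Lk.tail l)
splitOnes-decreasing (suc zero ∷ Q)    l = splitOnes-decreasing Q (Lk.tail l)
splitOnes-decreasing (suc (suc q) ∷ Q) l =
  cons-decreasing (splitOnes-bounded (suc q) Q (decreasing-All≤ l)) (splitOnes-decreasing Q (Lk.tail l))

join-decreasing : ∀ X g → WeaklyDecreasing X → WeaklyDecreasing (map suc X ++ replicate g 1)
join-decreasing []      zero          _ = []
join-decreasing []      (suc zero)    _ = [-]
join-decreasing []      (suc (suc g)) _ = ≤-refl ∷ join-decreasing [] (suc g) []
join-decreasing (x ∷ X) g l =
  cons-decreasing (++⁺ (raise (decreasing-All≤ l)) (All-replicate g (s≤s z≤n))) (join-decreasing X g (Lk.tail l))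
  where
  raise : ∀ {Y} → All (_≤ x) Y → All (_≤ suc x) (map suc Y)
  raise []       = []
  raise (p ∷ ps) = s≤s p ∷ raise ps

removeStaircase-decreasing : ∀ D → WeaklyDecreasing (removeStaircase D)
removeStaircase-decreasing []      = []
removeStaircase-decreasing (s ∷ D) = join-decreasing (removeStaircase D) _ (removeStaircase-decreasing D)

removeStaircase-bounded : ∀ D → All (λ q → 1 ≤ q × q ≤ length D) (removeStaircase D)
removeStaircase-bounded []      = []
removeStaircase-bounded (s ∷ D) = ++⁺ (raise (removeStaircase-bounded D)) (All-replicate _ (s≤s z≤n , s≤s z≤n))
  where
  raise : ∀ {Y} → All (λ q → 1 ≤ q × q ≤ length D) Y → All (λ q → 1 ≤ q × q ≤ suc (length D)) (map suc Y)
  raise []              = []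
  raise ((_ , p) ∷ ps) = (s≤s z≤n , s≤s p) ∷ raise ps

headOr0<head : ∀ {s D} → StrictlyDecreasing (s ∷ D) → 1 ≤ s → headOr0 D < s
headOr0<head [-]     p = p
headOr0<head (r ∷ _) _ = r

sum-map-suc : ∀ X → sum (map suc X) ≡ sum X + length X
sum-map-suc []      = refl
sum-map-suc (x ∷ X) = trans (cong (suc x +_) (sum-map-suc X)) (regroup x (sum X) (length X))
  where
  regroup : ∀ a b c → suc a + (b + c) ≡ a + b + suc c
  regroup = solve-∀

sum-replicate-1 : ∀ g → sum (replicate g 1) ≡ g
sum-replicate-1 zero    = refl
sum-replicate-1 (suc g) = cong suc (sum-replicate-1 g)

+-suc-comm : ∀ h g → h + suc g ≡ g + suc h
+-suc-comm h g = trans (+-suc h g) (trans (cong suc (+-comm h g)) (sym (+-suc g h)))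

removeStaircase-length : ∀ D → StrictlyDecreasing D → All (1 ≤_) D →
                         length (removeStaircase D) + length D ≡ headOr0 D
removeStaircase-length [] _ _ = refl
removeStaircase-length (s ∷ D) l (p ∷ pos) =
  begin
    length (map suc X ++ replicate g 1) + suc (length D)
      ≡⟨ cong (_+ suc (length D)) (trans (length-++ (map suc X)) (cong₂ _+_ (length-map suc X) (length-replicate g))) ⟩
    length X + g + suc (length D)
      ≡⟨ regroup (length X) g (length D) ⟩
    length X + length D + suc g
      ≡⟨ cong (_+ suc g) (removeStaircase-length D (Lk.tail l) pos) ⟩
    headOr0 D + suc g
      ≡⟨ +-suc-comm (headOr0 D) g ⟩
    g + suc (headOr0 D)
      ≡⟨ m∸n+n≡m (headOr0<head l p) ⟩
    s
  ∎
  where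
  open ≡-Reasoning
  X = removeStaircase D
  g = s ∸ suc (headOr0 D)
  regroup : ∀ a b c → a + b + suc c ≡ a + c + suc b
  regroup = solve-∀

removeStaircase-sum : ∀ D → StrictlyDecreasing D → All (1 ≤_) D →
                      sum (removeStaircase D) + tri (length D) ≡ sum D
removeStaircase-sum [] _ _ = refl
removeStaircase-sum (s ∷ D) l (p ∷ pos) =
  begin
    sum (map suc X ++ replicate g 1) + tri (suc (length D))
      ≡⟨ cong₂ _+_ (trans (sum-++ (map suc X) (replicate g 1)) (cong₂ _+_ (sum-map-suc X) (sum-replicate-1 g)))
                   (tri-suc (length D)) ⟩
    (sum X + length X + g) + (tri (length D) + suc (length D))
      ≡⟨ regroup (sum X) (length X) g (tri (length D)) (length D) ⟩
    (sum X + tri (length D)) + ((length X + length D) + suc g)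
      ≡⟨ cong₂ (λ a b → a + (b + suc g)) (removeStaircase-sum D (Lk.tail l) pos)
                                         (removeStaircase-length D (Lk.tail l) pos) ⟩
    sum D + (headOr0 D + suc g)
      ≡⟨ cong (sum D +_) (+-suc-comm (headOr0 D) g) ⟩
    sum D + (g + suc (headOr0 D))
      ≡⟨ cong (sum D +_) (m∸n+n≡m (headOr0<head l p)) ⟩
    sum D + s
      ≡⟨ +-comm (sum D) s ⟩
    s + sum D
  ∎
  where
  open ≡-Reasoning
  X = removeStaircase D
  g = s ∸ suc (headOr0 D)
  regroup : ∀ sx lx g c L → (sx + lx + g) + (c + suc L) ≡ (sx + c) + ((lx + L) + suc g)
  regroup = solve-∀

addStaircase-length : ∀ i Q → length (addStaircase i Q) ≡ i
addStaircase-length zero    Q = refl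
addStaircase-length (suc i) Q = cong suc (addStaircase-length i (proj₁ (splitOnes Q)))

addStaircase-positive : ∀ i Q → All (1 ≤_) (addStaircase i Q)
addStaircase-positive zero    Q = []
addStaircase-positive (suc i) Q = s≤s z≤n ∷ addStaircase-positive i (proj₁ (splitOnes Q))

addStaircase-decreasing : ∀ i Q → StrictlyDecreasing (addStaircase i Q)
addStaircase-decreasing zero    Q = []
addStaircase-decreasing (suc i) Q = cons-above _ _ (addStaircase-decreasing i (proj₁ (splitOnes Q)))
  where
  cons-above : ∀ g D → StrictlyDecreasing D → StrictlyDecreasing (suc (g + headOr0 D) ∷ D)
  cons-above g []      _ = [-]
  cons-above g (d ∷ D) l = s≤s (m≤n+m d g) ∷ l

add∘remove : ∀ D → StrictlyDecreasing D → All (1 ≤_) D → addStaircase (length D) (removeStaircase D) ≡ D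
add∘remove [] _ _ = refl
add∘remove (s ∷ D) l (p ∷ pos)
  rewrite splitOnes-join (removeStaircase D) (s ∸ suc (headOr0 D)) (All.map proj₁ (removeStaircase-bounded D))
        | add∘remove D (Lk.tail l) pos =
  cong (_∷ D) (trans (sym (+-suc (s ∸ suc (headOr0 D)) (headOr0 D))) (m∸n+n≡m (headOr0<head l p)))

remove∘add : ∀ i Q → PartsAtMost i Q → removeStaircase (addStaircase i Q) ≡ Q
remove∘add zero [] _ = refl
remove∘add zero (q ∷ Q) (_ , ((p , p') ∷ _)) = ⊥-elim (1+n≰n (≤-trans p p'))
remove∘add (suc i) Q (lQ , boundsQ) =
  trans (cong₂ (λ X k → map suc X ++ replicate k 1) (remove∘add i A partsA) (m+n∸n≡m g (headOr0 (addStaircase i A))))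
        (join-splitOnes Q lQ (All.map proj₁ boundsQ))
  where
  A = proj₁ (splitOnes Q)
  g = proj₂ (splitOnes Q)
  partsA : PartsAtMost i A
  partsA = splitOnes-decreasing Q lQ , All.zip (splitOnes-positive Q , splitOnes-bounded i Q (All.map proj₂ boundsQ))

distinct-sum : ∀ {i D} → Distinct i D → sum (removeStaircase D) + tri i ≡ sum D
distinct-sum {i} {D} (lD , posD , refl) = removeStaircase-sum D lD posD

staircase↔ : ∀ n i m → m + tri i ≡ n → Pairs (Distinct i) Decreasing n ↔ Pairs (PartsAtMost i) Decreasing m
staircase↔ n i m m+tri≡n = mk↔ₛ′ to from to-from from-to
  where
  shift : ∀ a b c → a + b + c ≡ a + c + b
  shift = solve-∀
  to : Pairs (Distinct i) Decreasing n → Pairs (PartsAtMost i) Decreasing m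
  to ((D , P) , distinct@(lD , posD , len) , decP , e) =
    (removeStaircase D , P) ,
    (removeStaircase-decreasing D , subst (λ L → All (λ q → 1 ≤ q × q ≤ L) (removeStaircase D)) len (removeStaircase-bounded D)) ,
    decP ,
    +-cancelʳ-≡ (tri i) _ _
      (trans (shift (sum (removeStaircase D)) (sum P) (tri i))
        (trans (cong (_+ sum P) (distinct-sum distinct)) (trans e (sym m+tri≡n))))
  from : Pairs (PartsAtMost i) Decreasing m → Pairs (Distinct i) Decreasing n
  from ((Q , P) , partsQ , decP , e) =
    (D , P) , distinct , decP ,
    trans (cong (_+ sum P) (sym sumD)) (trans (shift (sum Q) (tri i) (sum P)) (trans (cong (_+ tri i) e) m+tri≡n))
    where
    D = addStaircase i Q
    distinct : Distinct i D
    distinct = addStaircase-decreasing i Q , addStaircase-positive i Q , addStaircase-length i Q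
    sumD : sum Q + tri i ≡ sum D
    sumD = subst (λ X → sum X + tri i ≡ sum D) (remove∘add i Q partsQ) (distinct-sum distinct)
  to-from : ∀ y → to (from y) ≡ y
  to-from ((Q , P) , partsQ , _) =
    Pairs-≡ (PartsAtMost-irrelevant i) Decreasing-irrelevant (cong (_, P) (remove∘add i Q partsQ))
  from-to : ∀ x → from (to x) ≡ x
  from-to ((D , P) , (lD , posD , refl) , _) =
    Pairs-≡ (Distinct-irrelevant i) Decreasing-irrelevant (cong (_, P) (add∘remove D lD posD))

f↔TwoColPartition : ∀ n i m → m + tri i ≡ n → Fin (f n i) ↔ TwoColPartition i m
f↔TwoColPartition n i m m+tri≡n =
  ↔-trans (f↔OverWith n i)
  (↔-trans (OverWith↔Pairs n i)
  (↔-trans (staircase↔ n i m m+tri≡n)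
           (↔-sym (TwoColPartition↔Pairs i m))))

-- An overpartition with i overlined parts has weight at least tri(i),
-- hence f_{n,i} = 0 when n < tri(i).
f-vanishes : ∀ n i → n < tri i → f n i ≡ 0
f-vanishes n i n<tri = Fin-empty (λ x → <⇒≱ n<tri (weight≥tri (Inverse.to (OverWith↔Pairs n i) (Inverse.to (f↔OverWith n i) x))))
  where
  weight≥tri : Pairs (Distinct i) Decreasing n → tri i ≤ n
  weight≥tri ((D , P) , distinct , _ , e) =
    ≤-trans (≤-trans (m≤n+m (tri i) (sum (removeStaircase D))) (≤-reflexive (distinct-sum distinct)))
            (subst (sum D ≤_) e (m≤m+n (sum D) (sum P)))

tri-strict : ∀ j → tri j < tri (suc j)
tri-strict j = subst (tri j <_) (sym (tri-suc j)) (m<m+n (tri j) (s≤s z≤n))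

tri-mono : ∀ {j k} → j ≤ k → tri j ≤ tri k
tri-mono {j} {zero} z≤n = ≤-refl
tri-mono {j} {suc k} p with m≤n⇒m<n∨m≡n p
... | inj₂ refl = ≤-refl
... | inj₁ q    = ≤-trans (tri-mono (s≤s⁻¹ q)) (<⇒≤ (tri-strict k))

triangular-bracket : ∀ n → ∃ λ t → tri t ≤ n × n < tri (suc t)
triangular-bracket zero = 0 , z≤n , s≤s z≤n
triangular-bracket (suc n) with triangular-bracket n
... | t , tri≤n , n<tri with suc n <? tri (suc t)
...   | yes 1+n<tri = t , m≤n⇒m≤1+n tri≤n , 1+n<tri
...   | no  1+n≮tri = suc t , ≤-reflexive (sym 1+n≡tri) , subst (_< tri (suc (suc t))) (sym 1+n≡tri) (tri-strict (suc t))
  where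
  1+n≡tri : suc n ≡ tri (suc t)
  1+n≡tri = ≤-antisym n<tri (≮⇒≥ 1+n≮tri)

allOnes : ∀ i m → TwoColPartition i m
allOnes i m = replicate m (1 , false) , positive m , plain m , linked m , total m
  where
  positive : ∀ m → All (λ p → 1 ≤ proj₁ p) (replicate m (1 , false))
  positive zero    = []
  positive (suc m) = s≤s z≤n ∷ positive m
  plain : ∀ m → All (ColourOK i) (replicate m (1 , false))
  plain zero    = []
  plain (suc m) = tt ∷ plain m
  linked : ∀ m → Linked ColLink (replicate m (1 , false))
  linked zero          = []
  linked (suc zero)    = [-]
  linked (suc (suc m)) = inj₂ (refl , b≤b) ∷ linked (suc m)
  total : ∀ m → sum (map proj₁ (replicate m (1 , false))) ≡ m
  total zero    = refl
  total (suc m) = cong suc (total m)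

-- The degree t_n of f_n is the t with tri(t) ≤ n < tri(t + 1): the
-- coefficient f_{n,t} counts the all-ones partition of n - tri(t), and
-- higher coefficients vanish.
degree : ∀ n → ∃ λ t → IsDegree n t × (tri t ≤ n) × (n < tri (suc t))
degree n with triangular-bracket n
... | t , tri≤n , n<tri = t , (nonzero , above) , tri≤n , n<tri
  where
  nonzero : f n t ≡ 0 → ⊥
  nonzero f≡0 with subst Fin f≡0 (Inverse.from (f↔TwoColPartition n t (n ∸ tri t) (m∸n+n≡m tri≤n)) (allOnes t (n ∸ tri t)))
  ... | ()
  above : ∀ i → t < i → f n i ≡ 0
  above i t<i = f-vanishes n i (<-≤-trans n<tri (tri-mono t<i))

mainTheorem2 : (n : ℕ) →
    (∃ λ t → IsDegree n t × (suc t C 2 ≤ n) × (n < suc (suc t) C 2))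
    × (∀ i → Fin (f n i) ↔ Σ (Overpartition n) (λ o → numOverlined (proj₁ o) ≡ i))
    × (∀ i k (e : Fin k ↔ Partition n) →
         f n i ≡ sumFin k (λ j → ℓ₀ (proj₁ (Inverse.to e j)) C i))
    × (∀ (u k : ℕ) (e : Fin k ↔ Partition n) →
         fEval n u ≡ sumFin k (λ j → (1 + u) ^ ℓ₀ (proj₁ (Inverse.to e j))))
    × (∀ i m → m + suc i C 2 ≡ n → Fin (f n i) ↔ TwoColPartition i m)
    × (∀ i → n < suc i C 2 → f n i ≡ 0)
mainTheorem2 n =
  degree n ,
  f↔OverWith n ,
  f≡Σbinomial n ,
  fEval≡Σpower n ,
  f↔TwoColPartition n ,
  f-vanishes n
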